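{- Let $M$ be a matroid on $S$, $N$ a matroid on $T$ with $S\cap T=\emptyset$, let $P=M\mathbin{\Box} N$, and let $U\subseteq V\subseteq S\cup T$. Then $$P(U,V)=(\mathrm{T}^jM)(U\cap S,V\cap S)\mathbin{\Box}(\mathrm{L}^iN)(U\cap T,V\cap T),$$ where $j=\nu_N(U\cap T)$ and $i=\lambda_M(V\cap S)$.
   Context: For a matroid $M$ on $S$, $\rho(M)$ is its rank, $\nu_M(A)=|A|-\rho_M(A)$, $\lambda_M(A)=\rho(M)-\rho_M(A)$. The free product $M\mathbin{\Box} N$ of $M$ on $S$ and $N$ on $T$ ($S\cap T=\emptyset$) is the matroid on $S\cup T$ whose independent sets are the $A$ with $A\cap S$ independent in $M$ and $\lambda_M(A\cap S)\geq\nu_N(A\cap T)$. For $A\subseteq B\subseteq S$, $M(A,B)$ denotes the minor $(M|B)/A$ on $B\setminus A$. The truncation $\mathrm{T}M$ of $M$ is the matroid on $S$ whose independent sets are the independent sets $A$ of $M$ with $|A|\le\max\{0,\rho(M)-1\}$; the (Higgs) lift $\mathrm{L}M$ is the matroid on $S$ whose independent sets are the $A\subseteq S$ with $\nu_M(A)\le 1$. $\mathrm{T}^i$ and $\mathrm{L}^i$ denote $i$-fold iterates ($\mathrm{T}^0M=\mathrm{L}^0M=M$). -}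

module Defs where

open import Data.Nat using (ℕ; zero; suc; _+_; _∸_; _≤_; _<_; _⊔_)
open import Data.Nat.Properties using (_≟_; _≤?_)
open import Data.Fin using (Fin)
open import Data.Fin.Subset
  using (Subset; _∈_; _∉_; _⊆_; _∩_; _∪_; ∁; ⁅_⁆; ∣_∣; ⊥; Empty)
  renaming (_─_ to _∖_)
open import Data.Fin.Subset.Properties using (_⊆?_)
open import Data.Bool using (Bool; true; false)
open import Data.Vec using (Vec; []; _∷_)
open import Data.List as L using (List; filter; foldr)
open import Data.Product using (_×_; ∃; _,_)
open import Relation.Nullary using (¬_)
open import Relation.Nullary.Decidable using (_×-dec_)
open import Relation.Unary using (Decidable)
open import Relation.Binary.PropositionalEquality using (_≡_)
open import Function.Bundles using (_⇔_)

-- Ground sets live inside the finite universe Fin n; a subset is a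
-- Subset n.

record SetSystem (n : ℕ) : Set₁ where
  field
    ground : Subset n
    Indep  : Subset n → Set
    indep? : Decidable Indep
open SetSystem public

allSubsets : (n : ℕ) → List (Subset n)
allSubsets zero    = [] L.∷ L.[]
allSubsets (suc n) =
  L.map (false ∷_) (allSubsets n) L.++ L.map (true ∷_) (allSubsets n)

maxℕ : List ℕ → ℕ
maxℕ = foldr _⊔_ 0

rank : ∀ {n} → SetSystem n → Subset n → ℕ
rank {n} M A =
  maxℕ (L.map ∣_∣ (filter (λ B → (B ⊆? A) ×-dec indep? M B) (allSubsets n)))

rk : ∀ {n} → SetSystem n → ℕ
rk M = rank M (ground M)

nullity : ∀ {n} → SetSystem n → Subset n → ℕ
nullity M A = ∣ A ∣ ∸ rank M A

corank : ∀ {n} → SetSystem n → Subset n → ℕ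
corank M A = rk M ∸ rank M A

record IsMatroid {n : ℕ} (M : SetSystem n) : Set where
  field
    indep-ground : ∀ A → Indep M A → A ⊆ ground M
    indep-empty  : Indep M ⊥
    indep-hered  : ∀ A B → A ⊆ B → Indep M B → Indep M A
    indep-aug    : ∀ A B → Indep M A → Indep M B → ∣ A ∣ < ∣ B ∣ →
                   ∃ λ x → x ∈ B × x ∉ A × Indep M (A ∪ ⁅ x ⁆)

Disjoint : ∀ {n} → Subset n → Subset n → Set
Disjoint S T = Empty (S ∩ T)

freeProduct : ∀ {n} → SetSystem n → SetSystem n → SetSystem n
freeProduct M N = record
  { ground = ground M ∪ ground N
  ; Indep  = λ A → (A ⊆ ground M ∪ ground N)
                 × Indep M (A ∩ ground M)
                 × (nullity N (A ∩ ground N) ≤ corank M (A ∩ ground M))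
  ; indep? = λ A → (A ⊆? ground M ∪ ground N)
                 ×-dec (indep? M (A ∩ ground M)
                 ×-dec (nullity N (A ∩ ground N) ≤? corank M (A ∩ ground M)))
  }

restrict : ∀ {n} → SetSystem n → Subset n → SetSystem n
restrict M B = record
  { ground = ground M ∩ B
  ; Indep  = λ I → Indep M I × (I ⊆ B)
  ; indep? = λ I → indep? M I ×-dec (I ⊆? B)
  }

-- Contraction M / A: ground E ∖ A; I independent iff I ⊆ E ∖ A and
-- ρ_M(I ∪ A) = |I| + ρ_M(A)   (i.e. rank function ρ_M(X ∪ A) - ρ_M(A)).
contract : ∀ {n} → SetSystem n → Subset n → SetSystem n
contract M A = record
  { ground = ground M ∖ A
  ; Indep  = λ I → (I ⊆ ground M ∖ A) × (rank M (I ∪ A) ≡ ∣ I ∣ + rank M A)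
  ; indep? = λ I → (I ⊆? ground M ∖ A) ×-dec (rank M (I ∪ A) ≟ ∣ I ∣ + rank M A)
  }

minor : ∀ {n} → SetSystem n → Subset n → Subset n → SetSystem n
minor M A B = contract (restrict M B) A

-- Truncation: independent sets of M of size ≤ max{0, ρ(M) - 1} = ρ(M) ∸ 1
truncation : ∀ {n} → SetSystem n → SetSystem n
truncation M = record
  { ground = ground M
  ; Indep  = λ A → Indep M A × (∣ A ∣ ≤ rk M ∸ 1)
  ; indep? = λ A → indep? M A ×-dec (∣ A ∣ ≤? rk M ∸ 1)
  }

lift : ∀ {n} → SetSystem n → SetSystem n
lift M = record
  { ground = ground M
  ; Indep  = λ A → (A ⊆ ground M) × (nullity M A ≤ 1)
  ; indep? = λ A → (A ⊆? ground M) ×-dec (nullity M A ≤? 1)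
  }

iter : ∀ {n} → (SetSystem n → SetSystem n) → ℕ → SetSystem n → SetSystem n
iter f zero    M = M
iter f (suc k) M = f (iter f k M)

truncation^ : ∀ {n} → ℕ → SetSystem n → SetSystem n
truncation^ = iter truncation

lift^ : ∀ {n} → ℕ → SetSystem n → SetSystem n
lift^ = iter lift

infix 4 _≅_
_≅_ : ∀ {n} → SetSystem n → SetSystem n → Set
M ≅ N = (ground M ≡ ground N) × (∀ A → Indep M A ⇔ Indep N A)

{-# OPTIONS --safe #-}

-- Everything is decided by ranks. I is independent in P(U,V) iff ρ_P(I ∪ U) = |I| + ρ_P(U),
-- and, since M′ = T^j M(U ∩ S, V ∩ S) is a contraction, I is independent in M′ □ N′ iff
-- min(ρ_M′(I ∩ S) + |I ∩ T|, ρ(M′) + ρ_N′(I ∩ T)) = |I|. The rank of M □ N is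
-- min(ρ_M(X ∩ S) + |X ∩ T|, ρ(M) + ρ_N(X ∩ T)), contracting A subtracts ρ(A), T^j caps ranks
-- at ρ(M) − j and L^i turns ρ_N(X) into min(|X|, ρ_N(X) + i). Substituting these formulas,
-- ρ_P(I ∪ U) − ρ_P(U) and the free-product rank of I in M′ □ N′ become expressions in the
-- same eight ranks of M and N, and a case analysis on min and truncated subtraction shows
-- that they coincide.

module Submission where

open import Defs
open import Data.Bool using (true; false)
open import Data.Bool.Properties using (∧-comm; ∧-zeroʳ; ∨-zeroʳ)
open import Data.Empty using (⊥-elim)
open import Data.Fin using (Fin; zero; suc)
open import Data.Fin.Subset using (Subset; _⊆_; _∩_; _∪_; _─_; _∈_; _∉_; ⁅_⁆; ∣_∣; ⊥)
open import Data.Fin.Subset.Properties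
open import Data.List as List using (List)
open import Data.List.Membership.Propositional using () renaming (_∈_ to _∈ₗ_)
open import Data.List.Membership.Propositional.Properties
  using (∈-map∘filter⁻; ∈-map∘filter⁺; ∈-map⁺; ∈-++⁺ˡ; ∈-++⁺ʳ)
import Data.List.Relation.Unary.Any as Any
open import Data.Nat
  using (ℕ; zero; suc; _+_; _∸_; _≤_; _<_; _⊓_; _⊔_; z≤n; s≤s; s≤s⁻¹; _≤?_; _<?_)
open import Data.Nat.Properties
open import Algebra.Properties.CommutativeSemigroup +-commutativeSemigroup
  using (x∙yz≈y∙xz; interchange)
open import Data.Nat.Tactic.RingSolver using (solve-∀)
open import Data.Product using (_×_; ∃; _,_; proj₂)
open import Data.Product.Function.NonDependent.Propositional using (_×-⇔_)
open import Data.Sum using (_⊎_; inj₁; inj₂)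
open import Data.Vec using ([]; _∷_; here; there)
open import Function.Base using (_∘_)
open import Function.Bundles using (_⇔_; mk⇔; Equivalence)
open import Function.Construct.Identity using (⇔-id)
open import Function.Construct.Symmetry using (⇔-sym)
import Function.Related.Propositional as Related
open import Relation.Binary.PropositionalEquality
  using (_≡_; refl; sym; trans; cong; cong₂; subst; subst₂; module ≡-Reasoning)
open import Relation.Nullary using (yes; no)
open import Relation.Nullary.Decidable using (_×-dec_)
open import Relation.Unary using (Decidable)

private variable
  n : ℕ
  x : Fin n
  p q r p′ q′ : Subset n
  A B X Y U V : Subset n

-- Finite sets

x∈p─q⇒x∉q : ∀ (p q : Subset n) → x ∈ p ─ q → x ∉ q
x∈p─q⇒x∉q (_ ∷ p) (true  ∷ q) ()        here
x∈p─q⇒x∉q (_ ∷ p) (false ∷ q) here      ()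
x∈p─q⇒x∉q (_ ∷ p) (_     ∷ q) (there x∈p─q) (there x∈q) = x∈p─q⇒x∉q p q x∈p─q x∈q

∪-least : p ⊆ r → q ⊆ r → p ∪ q ⊆ r
∪-least {p = p} {q = q} p⊆r q⊆r x∈p∪q with x∈p∪q⁻ p q x∈p∪q
... | inj₁ x∈p = p⊆r x∈p
... | inj₂ x∈q = q⊆r x∈q

∩-greatest : p ⊆ q → p ⊆ r → p ⊆ q ∩ r
∩-greatest p⊆q p⊆r x∈p = x∈p∩q⁺ (p⊆q x∈p , p⊆r x∈p)

∩-monoˡ-⊆ : ∀ r → p ⊆ q → p ∩ r ⊆ q ∩ r
∩-monoˡ-⊆ {p = p} r p⊆q = ∩-greatest (⊆-trans (p∩q⊆p p r) p⊆q) (p∩q⊆q p r)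

p⊆q⇒p∩q≡p : p ⊆ q → p ∩ q ≡ p
p⊆q⇒p∩q≡p {p = p} {q = q} p⊆q = ⊆-antisym (p∩q⊆p p q) (∩-greatest ⊆-refl p⊆q)

q⊆p⇒p∪q≡p : q ⊆ p → p ∪ q ≡ p
q⊆p⇒p∪q≡p {q = q} {p = p} q⊆p = ⊆-antisym (∪-least ⊆-refl q⊆p) (p⊆p∪q q)

p⊆q⇒p∩[q∩r]≡p∩r : ∀ r → p ⊆ q → p ∩ (q ∩ r) ≡ p ∩ r
p⊆q⇒p∩[q∩r]≡p∩r {p = p} {q = q} r p⊆q = trans (sym (∩-assoc p q r)) (cong (_∩ r) (p⊆q⇒p∩q≡p p⊆q))

p⊆[p─q]∪q : ∀ (p q : Subset n) → p ⊆ (p ─ q) ∪ q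
p⊆[p─q]∪q p q {x} x∈p with x ∈? q
... | yes x∈q = q⊆p∪q (p ─ q) q x∈q
... | no  x∉q = p⊆p∪q q (x∈p∧x∉q⇒x∈p─q x∈p x∉q)

[p∩q]─r≡[q─r]∩p : ∀ (p q r : Subset n) → (p ∩ q) ─ r ≡ (q ─ r) ∩ p
[p∩q]─r≡[q─r]∩p []      []      []          = refl
[p∩q]─r≡[q─r]∩p (s ∷ p) (t ∷ q) (true ∷ r)  = cong (false ∷_) ([p∩q]─r≡[q─r]∩p p q r)
[p∩q]─r≡[q─r]∩p (s ∷ p) (t ∷ q) (false ∷ r) = cong₂ _∷_ (∧-comm s t) ([p∩q]─r≡[q─r]∩p p q r)

[p∩r]─[q∩r]≡[p─q]∩r : ∀ (p q r : Subset n) → (p ∩ r) ─ (q ∩ r) ≡ (p ─ q) ∩ r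
[p∩r]─[q∩r]≡[p─q]∩r []      []          []          = refl
[p∩r]─[q∩r]≡[p─q]∩r (s ∷ p) (true  ∷ q) (true  ∷ r) = cong (false ∷_) ([p∩r]─[q∩r]≡[p─q]∩r p q r)
[p∩r]─[q∩r]≡[p─q]∩r (s ∷ p) (true  ∷ q) (false ∷ r) = cong₂ _∷_ (∧-zeroʳ s) ([p∩r]─[q∩r]≡[p─q]∩r p q r)
[p∩r]─[q∩r]≡[p─q]∩r (s ∷ p) (false ∷ q) (w     ∷ r) = cong (_ ∷_) ([p∩r]─[q∩r]≡[p─q]∩r p q r)

[p─q]∪q≡p∪q : ∀ (p q : Subset n) → (p ─ q) ∪ q ≡ p ∪ q
[p─q]∪q≡p∪q []      []          = refl
[p─q]∪q≡p∪q (s ∷ p) (true  ∷ q) = cong₂ _∷_ (sym (∨-zeroʳ s)) ([p─q]∪q≡p∪q p q)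
[p─q]∪q≡p∪q (s ∷ p) (false ∷ q) = cong (_ ∷_) ([p─q]∪q≡p∪q p q)

disjoint-mono : p ⊆ q → p′ ⊆ q′ → Disjoint q q′ → Disjoint p p′
disjoint-mono {p = p} {p′ = p′} p⊆q p′⊆q′ q∩q′=∅ (x , x∈p∩p′) =
  q∩q′=∅ (x , x∈p∩q⁺ (p⊆q (p∩q⊆p p p′ x∈p∩p′) , p′⊆q′ (p∩q⊆q p p′ x∈p∩p′)))

disjoint-─ : ∀ (p q : Subset n) → Disjoint (p ─ q) q
disjoint-─ p q (x , x∈) = x∈p─q⇒x∉q p q (p∩q⊆p (p ─ q) q x∈) (p∩q⊆q (p ─ q) q x∈)

∣p∪q∣≡∣p∣+∣q∣ : ∀ (p q : Subset n) → Disjoint p q → ∣ p ∪ q ∣ ≡ ∣ p ∣ + ∣ q ∣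
∣p∪q∣≡∣p∣+∣q∣ []          []          _     = refl
∣p∪q∣≡∣p∣+∣q∣ (true  ∷ p) (true  ∷ q) p∩q=∅ = ⊥-elim (p∩q=∅ (zero , here))
∣p∪q∣≡∣p∣+∣q∣ (true  ∷ p) (false ∷ q) p∩q=∅ = cong suc (∣p∪q∣≡∣p∣+∣q∣ p q (drop-∷-Empty p∩q=∅))
∣p∪q∣≡∣p∣+∣q∣ (false ∷ p) (true  ∷ q) p∩q=∅ =
  trans (cong suc (∣p∪q∣≡∣p∣+∣q∣ p q (drop-∷-Empty p∩q=∅))) (sym (+-suc ∣ p ∣ ∣ q ∣))
∣p∪q∣≡∣p∣+∣q∣ (false ∷ p) (false ∷ q) p∩q=∅ = ∣p∪q∣≡∣p∣+∣q∣ p q (drop-∷-Empty p∩q=∅)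

∣p∣≡∣p∩q∣+∣p─q∣ : ∀ (p q : Subset n) → ∣ p ∣ ≡ ∣ p ∩ q ∣ + ∣ p ─ q ∣
∣p∣≡∣p∩q∣+∣p─q∣ []          []          = refl
∣p∣≡∣p∩q∣+∣p─q∣ (true  ∷ p) (true  ∷ q) = cong suc (∣p∣≡∣p∩q∣+∣p─q∣ p q)
∣p∣≡∣p∩q∣+∣p─q∣ (true  ∷ p) (false ∷ q) = trans (cong suc (∣p∣≡∣p∩q∣+∣p─q∣ p q)) (sym (+-suc _ _))
∣p∣≡∣p∩q∣+∣p─q∣ (false ∷ p) (true  ∷ q) = ∣p∣≡∣p∩q∣+∣p─q∣ p q
∣p∣≡∣p∩q∣+∣p─q∣ (false ∷ p) (false ∷ q) = ∣p∣≡∣p∩q∣+∣p─q∣ p q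

∣p∣≡∣p∩q∣+∣p∩r∣ : ∀ (p q r : Subset n) → p ⊆ q ∪ r → Disjoint q r →
                  ∣ p ∣ ≡ ∣ p ∩ q ∣ + ∣ p ∩ r ∣
∣p∣≡∣p∩q∣+∣p∩r∣ p q r p⊆q∪r q∩r=∅ = begin
  ∣ p ∣                 ≡⟨ cong ∣_∣ (sym (p⊆q⇒p∩q≡p p⊆q∪r)) ⟩
  ∣ p ∩ (q ∪ r) ∣       ≡⟨ cong ∣_∣ (∩-distribˡ-∪ p q r) ⟩
  ∣ p ∩ q ∪ p ∩ r ∣     ≡⟨ ∣p∪q∣≡∣p∣+∣q∣ (p ∩ q) (p ∩ r)
                             (disjoint-mono (p∩q⊆q p q) (p∩q⊆q p r) q∩r=∅) ⟩
  ∣ p ∩ q ∣ + ∣ p ∩ r ∣ ∎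
  where open ≡-Reasoning

∣p∪⁅x⁆∣≡1+∣p∣ : ∀ (p : Subset n) → x ∉ p → ∣ p ∪ ⁅ x ⁆ ∣ ≡ suc ∣ p ∣
∣p∪⁅x⁆∣≡1+∣p∣ {x = x} p x∉p = begin
  ∣ p ∪ ⁅ x ⁆ ∣     ≡⟨ ∣p∪q∣≡∣p∣+∣q∣ p ⁅ x ⁆ p∩⁅x⁆=∅ ⟩
  ∣ p ∣ + ∣ ⁅ x ⁆ ∣ ≡⟨ cong (∣ p ∣ +_) (∣⁅x⁆∣≡1 x) ⟩
  ∣ p ∣ + 1         ≡⟨ +-comm ∣ p ∣ 1 ⟩
  suc ∣ p ∣         ∎
  where
  open ≡-Reasoning
  p∩⁅x⁆=∅ : Disjoint p ⁅ x ⁆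
  p∩⁅x⁆=∅ (y , y∈p∩⁅x⁆) with x∈p∩q⁻ p ⁅ x ⁆ y∈p∩⁅x⁆
  ... | y∈p , y∈⁅x⁆ = x∉p (subst (_∈ p) (x∈⁅y⁆⇒x≡y x y∈⁅x⁆) y∈p)

∣p∣<∣q∣⇒∃[x∈q─p] : ∀ (p q : Subset n) → ∣ p ∣ < ∣ q ∣ → ∃ λ x → x ∈ q × x ∉ p
∣p∣<∣q∣⇒∃[x∈q─p] {n} p q ∣p∣<∣q∣ with nonempty? (q ─ p)
... | yes (x , x∈q─p) = x , p─q⊆p q p x∈q─p , x∈p─q⇒x∉q q p x∈q─p
... | no  q─p=∅       = ⊥-elim (<⇒≱ ∣p∣<∣q∣ (begin
  ∣ q ∣                     ≡⟨ ∣p∣≡∣p∩q∣+∣p─q∣ q p ⟩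
  ∣ q ∩ p ∣ + ∣ q ─ p ∣     ≡⟨ cong (λ r → ∣ q ∩ p ∣ + ∣ r ∣) (Empty-unique q─p=∅) ⟩
  ∣ q ∩ p ∣ + ∣ ⊥ {n = n} ∣ ≡⟨ trans (cong (∣ q ∩ p ∣ +_) (∣⊥∣≡0 n)) (+-identityʳ _) ⟩
  ∣ q ∩ p ∣                 ≤⟨ ∣p∩q∣≤∣q∣ q p ⟩
  ∣ p ∣                     ∎))
  where open ≤-Reasoning

⊆-extend : ∀ (p q : Subset n) k → p ⊆ q → k + ∣ p ∣ ≤ ∣ q ∣ →
           ∃ λ r → p ⊆ r × r ⊆ q × ∣ r ∣ ≡ k + ∣ p ∣
⊆-extend []          []          k       _   k≤0 = [] , ⊆-refl , ⊆-refl , sym (n≤0⇒n≡0 k≤0)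
⊆-extend (true  ∷ p) (false ∷ q) k       p⊆q _   with () ← p⊆q here
⊆-extend (false ∷ p) (false ∷ q) k       p⊆q le  with ⊆-extend p q k (drop-∷-⊆ p⊆q) le
... | r , p⊆r , r⊆q , ∣r∣ = false ∷ r , s⊆s p⊆r , s⊆s r⊆q , ∣r∣
⊆-extend (true  ∷ p) (true  ∷ q) k       p⊆q le
  with ⊆-extend p q k (drop-∷-⊆ p⊆q) (s≤s⁻¹ (subst (_≤ suc ∣ q ∣) (+-suc k ∣ p ∣) le))
... | r , p⊆r , r⊆q , ∣r∣ = true ∷ r , s⊆s p⊆r , s⊆s r⊆q , trans (cong suc ∣r∣) (sym (+-suc k ∣ p ∣))
⊆-extend (false ∷ p) (true  ∷ q) zero    p⊆q _   = false ∷ p , ⊆-refl , p⊆q , refl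
⊆-extend (false ∷ p) (true  ∷ q) (suc k) p⊆q le  with ⊆-extend p q k (drop-∷-⊆ p⊆q) (s≤s⁻¹ le)
... | r , p⊆r , r⊆q , ∣r∣ = true ∷ r , out⊆ p⊆r , s⊆s r⊆q , cong suc ∣r∣

p⊆q∧∣q∣≤∣p∣⇒q⊆p : p ⊆ q → ∣ q ∣ ≤ ∣ p ∣ → q ⊆ p
p⊆q∧∣q∣≤∣p∣⇒q⊆p {p = p} {q = q} p⊆q ∣q∣≤∣p∣ {x} x∈q with x ∈? p
... | yes x∈p = x∈p
... | no  x∉p = ⊥-elim (<⇒≱ ∣p∣<∣q∣ ∣q∣≤∣p∣)
  where
  ∣p∣<∣q∣ : ∣ p ∣ < ∣ q ∣
  ∣p∣<∣q∣ = subst (_≤ ∣ q ∣) (∣p∪⁅x⁆∣≡1+∣p∣ p x∉p)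
              (p⊆q⇒∣p∣≤∣q∣ (∪-least p⊆q (λ y∈⁅x⁆ → subst (_∈ q) (sym (x∈⁅y⁆⇒x≡y x y∈⁅x⁆)) x∈q)))

x∈p⇒⁅x⁆⊆p : x ∈ p → ⁅ x ⁆ ⊆ p
x∈p⇒⁅x⁆⊆p {x = x} {p = p} x∈p y∈⁅x⁆ = subst (_∈ p) (sym (x∈⁅y⁆⇒x≡y x y∈⁅x⁆)) x∈p

p⊆q∪r⇒p─r⊆q : ∀ (p q r : Subset n) → p ⊆ q ∪ r → p ─ r ⊆ q
p⊆q∪r⇒p─r⊆q p q r p⊆q∪r x∈p─r with x∈p∪q⁻ q r (p⊆q∪r (p─q⊆p p r x∈p─r))
... | inj₁ x∈q = x∈q
... | inj₂ x∈r = ⊥-elim (x∈p─q⇒x∉q p r x∈p─r x∈r)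

∃-⊆-of-size : ∀ (p : Subset n) k → k ≤ ∣ p ∣ → ∃ λ r → r ⊆ p × ∣ r ∣ ≡ k
∃-⊆-of-size {n} p k k≤∣p∣ =
  let r , _ , r⊆p , ∣r∣ = ⊆-extend ⊥ p k ⊥⊆ (subst (_≤ ∣ p ∣) (sym k+∣⊥∣≡k) k≤∣p∣)
  in r , r⊆p , trans ∣r∣ k+∣⊥∣≡k
  where
  k+∣⊥∣≡k : k + ∣ ⊥ {n = n} ∣ ≡ k
  k+∣⊥∣≡k = trans (cong (k +_) (∣⊥∣≡0 n)) (+-identityʳ k)

⊆×-cong : ∀ {P P′ : Set} → p ≡ q → (r ⊆ q → P ⇔ P′) → (r ⊆ p × P) ⇔ (r ⊆ q × P′)
⊆×-cong refl P⇔P′ = mk⇔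
  (λ (r⊆q , P) → (λ {_} → r⊆q) , Equivalence.to (P⇔P′ r⊆q) P)
  (λ (r⊆q , P′) → (λ {_} → r⊆q) , Equivalence.from (P⇔P′ r⊆q) P′)

[p∪q]∩r⊆p : ∀ {p q r : Subset n} → Disjoint r q → (p ∪ q) ∩ r ⊆ p
[p∪q]∩r⊆p {p = p} {q} {r} r∩q=∅ {x} x∈ with x∈p∩q⁻ (p ∪ q) r x∈
... | x∈p∪q , x∈r with x∈p∪q⁻ p q x∈p∪q
...   | inj₁ x∈p = x∈p
...   | inj₂ x∈q = ⊥-elim (r∩q=∅ (x , x∈p∩q⁺ (x∈r , x∈q)))

[p∪q]∩r⊆q : ∀ {p q r : Subset n} → Disjoint p r → (p ∪ q) ∩ r ⊆ q
[p∪q]∩r⊆q {p = p} {q} {r} p∩r=∅ {x} x∈ with x∈p∩q⁻ (p ∪ q) r x∈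
... | x∈p∪q , x∈r with x∈p∪q⁻ p q x∈p∪q
...   | inj₁ x∈p = ⊥-elim (p∩r=∅ (x , x∈p∩q⁺ (x∈p , x∈r)))
...   | inj₂ x∈q = x∈q

-- Arithmetic

m∸n≤o⇒m≤n+o : ∀ m n {o} → m ∸ n ≤ o → m ≤ n + o
m∸n≤o⇒m≤n+o m n m∸n≤o = ≤-trans (m≤n+m∸n m n) (+-monoʳ-≤ n m∸n≤o)

m∸n≤1⇔m≤1+n : ∀ m n → (m ∸ n ≤ 1) ⇔ (m ≤ suc n)
m∸n≤1⇔m≤1+n m n = mk⇔
  (λ m∸n≤1 → subst (m ≤_) (+-comm n 1) (m∸n≤o⇒m≤n+o m n m∸n≤1))
  (λ m≤1+n → m≤n+o⇒m∸n≤o m n (subst (m ≤_) (+-comm 1 n) m≤1+n))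

m∸[m⊓n]≡m∸n : ∀ m n → m ∸ (m ⊓ n) ≡ m ∸ n
m∸[m⊓n]≡m∸n m n = trans (∸-distribˡ-⊓-⊔ m m n) (cong (_⊔ (m ∸ n)) (n∸n≡0 m))

m+n≤p+o⇔n∸o≤p∸m : ∀ m n o p → m ≤ p → (m + n ≤ p + o) ⇔ (n ∸ o ≤ p ∸ m)
m+n≤p+o⇔n∸o≤p∸m m n o p m≤p = mk⇔
  (λ m+n≤p+o → begin
    n ∸ o               ≤⟨ ∸-monoˡ-≤ o (m+n≤o⇒m≤o∸n n (subst (_≤ p + o) (+-comm m n) m+n≤p+o)) ⟩
    p + o ∸ m ∸ o       ≡⟨ ∸-+-assoc (p + o) m o ⟩
    p + o ∸ (m + o)     ≡⟨ cong₂ _∸_ (+-comm p o) (+-comm m o) ⟩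
    o + p ∸ (o + m)     ≡⟨ [m+n]∸[m+o]≡n∸o o p m ⟩
    p ∸ m               ∎)
  (λ n∸o≤p∸m → begin
    m + n               ≤⟨ +-monoʳ-≤ m (m∸n≤o⇒m≤n+o n o n∸o≤p∸m) ⟩
    m + (o + (p ∸ m))   ≡⟨ x∙yz≈y∙xz m o (p ∸ m) ⟩
    o + (m + (p ∸ m))   ≡⟨ cong (o +_) (m+[n∸m]≡n m≤p) ⟩
    o + p               ≡⟨ +-comm o p ⟩
    p + o               ∎)
  where open ≤-Reasoning

freeProduct-indep-arith : ∀ {x p q y z} → x ≤ p → x ≤ y →
  (x ≡ p × q ∸ z ≤ y ∸ x) ⇔ ((x + q) ⊓ (y + z) ≡ p + q)
freeProduct-indep-arith {x} {p} {q} {y} {z} x≤p x≤y = mk⇔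
  (λ { (refl , q∸z≤y∸x) → m≤n⇒m⊓n≡m (Equivalence.from (m+n≤p+o⇔n∸o≤p∸m x q z y x≤y) q∸z≤y∸x) })
  (λ min≡p+q →
    let p+q≤x+q = subst (_≤ x + q) min≡p+q (m⊓n≤m (x + q) (y + z))
        x≡p     = ≤-antisym x≤p (+-cancelʳ-≤ q p x p+q≤x+q)
    in  x≡p , Equivalence.to (m+n≤p+o⇔n∸o≤p∸m x q z y x≤y)
                (subst (λ w → w + q ≤ y + z) (sym x≡p) (subst (_≤ y + z) min≡p+q (m⊓n≤n (x + q) (y + z)))))

m+[[n∸o]⊓[p∸m]+o]≡[m+n]⊓[p+o] : ∀ m n o p → m ≤ p → o ≤ n →
  m + ((n ∸ o) ⊓ (p ∸ m) + o) ≡ (m + n) ⊓ (p + o)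
m+[[n∸o]⊓[p∸m]+o]≡[m+n]⊓[p+o] m n o p m≤p o≤n = begin
  m + ((n ∸ o) ⊓ (p ∸ m) + o)       ≡⟨ cong (m +_) (+-distribʳ-⊓ o (n ∸ o) (p ∸ m)) ⟩
  m + ((n ∸ o + o) ⊓ (p ∸ m + o))   ≡⟨ cong (λ k → m + k ⊓ (p ∸ m + o)) (m∸n+n≡m o≤n) ⟩
  m + n ⊓ (p ∸ m + o)               ≡⟨ +-distribˡ-⊓ m n (p ∸ m + o) ⟩
  (m + n) ⊓ (m + (p ∸ m + o))       ≡⟨ cong ((m + n) ⊓_) (sym (+-assoc m (p ∸ m) o)) ⟩
  (m + n) ⊓ (m + (p ∸ m) + o)       ≡⟨ cong (λ k → (m + n) ⊓ (k + o)) (m+[n∸m]≡n m≤p) ⟩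
  (m + n) ⊓ (p + o)                 ∎
  where open ≡-Reasoning

[m+n]⊓o≡m⊓o+n⊓[o∸m] : ∀ m n o → (m + n) ⊓ o ≡ m ⊓ o + n ⊓ (o ∸ m)
[m+n]⊓o≡m⊓o+n⊓[o∸m] m n o with ≤-total m o
... | inj₁ m≤o with m≤n⇒∃[o]m+o≡n m≤o
...   | k , refl = begin
  (m + n) ⊓ (m + k)                 ≡⟨ sym (+-distribˡ-⊓ m n k) ⟩
  m + n ⊓ k                         ≡⟨ cong (_+ n ⊓ k) (sym (m≤n⇒m⊓n≡m (m≤m+n m k))) ⟩
  m ⊓ (m + k) + n ⊓ k               ≡⟨ cong (λ d → m ⊓ (m + k) + n ⊓ d) (sym (m+n∸m≡n m k)) ⟩
  m ⊓ (m + k) + n ⊓ (m + k ∸ m)     ∎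
  where open ≡-Reasoning
[m+n]⊓o≡m⊓o+n⊓[o∸m] m n o | inj₂ o≤m = begin
  (m + n) ⊓ o          ≡⟨ m≥n⇒m⊓n≡n (≤-trans o≤m (m≤m+n m n)) ⟩
  o                    ≡⟨ sym (+-identityʳ o) ⟩
  o + 0                ≡⟨ cong₂ _+_ (sym (m≥n⇒m⊓n≡n o≤m)) (sym (⊓-zeroʳ n)) ⟩
  m ⊓ o + n ⊓ 0        ≡⟨ cong (λ d → m ⊓ o + n ⊓ d) (sym (m≤n⇒m∸n≡0 o≤m)) ⟩
  m ⊓ o + n ⊓ (o ∸ m)  ∎
  where open ≡-Reasoning

x+m⊓o≡[m+n]⊓o⇒x≡n⊓[o∸m] : ∀ {x} m n o → x + m ⊓ o ≡ (m + n) ⊓ o → x ≡ n ⊓ (o ∸ m)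
x+m⊓o≡[m+n]⊓o⇒x≡n⊓[o∸m] {x} m n o eq = +-cancelʳ-≡ (m ⊓ o) x (n ⊓ (o ∸ m))
  (trans eq (trans ([m+n]⊓o≡m⊓o+n⊓[o∸m] m n o) (+-comm (m ⊓ o) (n ⊓ (o ∸ m)))))

κ⊓e≡κ⊓[γ⊓e+κ⊓[g∸j]] : ∀ κ γ g j e → j + e ≡ γ + g → κ ⊓ e ≡ κ ⊓ (γ ⊓ e + κ ⊓ (g ∸ j))
κ⊓e≡κ⊓[γ⊓e+κ⊓[g∸j]] κ γ g j e j+e≡γ+g with ≤-total j g
... | inj₁ j≤g with m≤n⇒∃[o]m+o≡n j≤g
...   | h , refl = begin
  κ ⊓ e                                  ≡⟨ cong (κ ⊓_) e≡γ+h ⟩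
  κ ⊓ (γ + h)                            ≡⟨ cong (_⊓ (γ + h)) (sym (m≤n⇒m⊓n≡m (m≤n+m κ γ))) ⟩
  (κ ⊓ (γ + κ)) ⊓ (γ + h)                ≡⟨ ⊓-assoc κ (γ + κ) (γ + h) ⟩
  κ ⊓ ((γ + κ) ⊓ (γ + h))                ≡⟨ cong (κ ⊓_) (sym (+-distribˡ-⊓ γ κ h)) ⟩
  κ ⊓ (γ + κ ⊓ h)                        ≡⟨ cong (λ a → κ ⊓ (a + κ ⊓ h)) (sym γ⊓e≡γ) ⟩
  κ ⊓ (γ ⊓ e + κ ⊓ h)                    ≡⟨ cong (λ d → κ ⊓ (γ ⊓ e + κ ⊓ d)) (sym (m+n∸m≡n j h)) ⟩
  κ ⊓ (γ ⊓ e + κ ⊓ (j + h ∸ j))          ∎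
  where
  open ≡-Reasoning
  e≡γ+h : e ≡ γ + h
  e≡γ+h = +-cancelˡ-≡ j e (γ + h) (trans j+e≡γ+g (x∙yz≈y∙xz γ j h))
  γ⊓e≡γ : γ ⊓ e ≡ γ
  γ⊓e≡γ = trans (cong (γ ⊓_) e≡γ+h) (m≤n⇒m⊓n≡m (m≤m+n γ h))
κ⊓e≡κ⊓[γ⊓e+κ⊓[g∸j]] κ γ g j e j+e≡γ+g | inj₂ g≤j = begin
  κ ⊓ e                              ≡⟨ cong (κ ⊓_) (sym (+-identityʳ e)) ⟩
  κ ⊓ (e + 0)                        ≡⟨ cong (λ a → κ ⊓ (a + 0)) (sym (m≥n⇒m⊓n≡n e≤γ)) ⟩
  κ ⊓ (γ ⊓ e + 0)                    ≡⟨ cong (λ b → κ ⊓ (γ ⊓ e + b)) (sym (⊓-zeroʳ κ)) ⟩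
  κ ⊓ (γ ⊓ e + κ ⊓ 0)                ≡⟨ cong (λ d → κ ⊓ (γ ⊓ e + κ ⊓ d)) (sym (m≤n⇒m∸n≡0 g≤j)) ⟩
  κ ⊓ (γ ⊓ e + κ ⊓ (g ∸ j))          ∎
  where
  open ≡-Reasoning
  e≤γ : e ≤ γ
  e≤γ = +-cancelʳ-≤ j e γ (subst (_≤ γ + j) (sym (trans (+-comm e j) j+e≡γ+g)) (+-monoʳ-≤ γ g≤j))

-- rank-identity after substituting a = b + α, c = a + γ, R = c + g, u = t₀ + j, t₁ = t₀ + δ,
-- q = δ + κ and cancelling b + t₀ + δ.
rank-identity-core : ∀ α γ g j κ →
  α + (κ + j) ⊓ (γ + g) ≡
  (α ⊓ (α + γ + g ∸ j) + κ) ⊓ ((α + γ) ⊓ (α + γ + g ∸ j) + κ ⊓ (g ∸ j)) + j ⊓ (α + γ + g)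
rank-identity-core α γ g j κ with ≤-total j (γ + g)
... | inj₁ j≤γ+g with m≤n⇒∃[o]m+o≡n j≤γ+g
...   | e , j+e≡γ+g = begin
  α + (κ + j) ⊓ (γ + g)  ≡⟨ cong (α +_) (cong₂ _⊓_ (+-comm κ j) (sym j+e≡γ+g)) ⟩
  α + (j + κ) ⊓ (j + e)  ≡⟨ cong (α +_) (sym (+-distribˡ-⊓ j κ e)) ⟩
  α + (j + κ ⊓ e)        ≡⟨ cong (λ t → α + (j + t)) (κ⊓e≡κ⊓[γ⊓e+κ⊓[g∸j]] κ γ g j e j+e≡γ+g) ⟩
  α + (j + κ ⊓ G)        ≡⟨ trans (x∙yz≈y∙xz α j (κ ⊓ G)) (+-comm j (α + κ ⊓ G)) ⟩
  α + κ ⊓ G + j          ≡⟨ cong (_+ j) (+-distribˡ-⊓ α κ G) ⟩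
  (α + κ) ⊓ (α + G) + j  ≡⟨ cong₂ (λ a b → (a + κ) ⊓ b + j) (sym α⊓E≡α) α+G≡ ⟩
  (α ⊓ E + κ) ⊓ ((α + γ) ⊓ E + κ ⊓ (g ∸ j)) + j
      ≡⟨ cong ((α ⊓ E + κ) ⊓ ((α + γ) ⊓ E + κ ⊓ (g ∸ j)) +_) (sym (m≤n⇒m⊓n≡m j≤W)) ⟩
  (α ⊓ E + κ) ⊓ ((α + γ) ⊓ E + κ ⊓ (g ∸ j)) + j ⊓ (α + γ + g) ∎
  where
  open ≡-Reasoning
  E G : ℕ
  E = α + γ + g ∸ j
  G = γ ⊓ e + κ ⊓ (g ∸ j)
  j≤W : j ≤ α + γ + g
  j≤W = ≤-trans j≤γ+g (subst (γ + g ≤_) (sym (+-assoc α γ g)) (m≤n+m (γ + g) α))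
  E≡α+e : E ≡ α + e
  E≡α+e = begin
    α + γ + g ∸ j     ≡⟨ cong (_∸ j) (+-assoc α γ g) ⟩
    α + (γ + g) ∸ j   ≡⟨ cong (λ w → α + w ∸ j) (sym j+e≡γ+g) ⟩
    α + (j + e) ∸ j   ≡⟨ cong (_∸ j) (x∙yz≈y∙xz α j e) ⟩
    j + (α + e) ∸ j   ≡⟨ m+n∸m≡n j (α + e) ⟩
    α + e             ∎
  α⊓E≡α : α ⊓ E ≡ α
  α⊓E≡α = trans (cong (α ⊓_) E≡α+e) (m≤n⇒m⊓n≡m (m≤m+n α e))
  α+G≡ : α + G ≡ (α + γ) ⊓ E + κ ⊓ (g ∸ j)
  α+G≡ = trans (sym (+-assoc α (γ ⊓ e) (κ ⊓ (g ∸ j))))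
               (cong (_+ κ ⊓ (g ∸ j)) (trans (+-distribˡ-⊓ α γ e) (cong ((α + γ) ⊓_) (sym E≡α+e))))
rank-identity-core α γ g j κ | inj₂ γ+g≤j = begin
  α + (κ + j) ⊓ (γ + g)  ≡⟨ cong (α +_) (m≥n⇒m⊓n≡n (≤-trans γ+g≤j (m≤n+m j κ))) ⟩
  α + (γ + g)            ≡⟨ sym (+-assoc α γ g) ⟩
  W                      ≡⟨ sym (m⊓n+n∸m≡n j W) ⟩
  j ⊓ W + E              ≡⟨ +-comm (j ⊓ W) E ⟩
  E + j ⊓ W              ≡⟨ cong (_+ j ⊓ W) (sym min≡E) ⟩
  (α ⊓ E + κ) ⊓ ((α + γ) ⊓ E + κ ⊓ (g ∸ j)) + j ⊓ W ∎
  where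
  open ≡-Reasoning
  W E : ℕ
  W = α + γ + g
  E = W ∸ j
  E≤α : E ≤ α
  E≤α = ≤-trans (∸-monoʳ-≤ W γ+g≤j)
          (≤-reflexive (trans (cong (_∸ (γ + g)) (+-assoc α γ g)) (m+n∸n≡m α (γ + g))))
  min≡E : (α ⊓ E + κ) ⊓ ((α + γ) ⊓ E + κ ⊓ (g ∸ j)) ≡ E
  min≡E = begin
    (α ⊓ E + κ) ⊓ ((α + γ) ⊓ E + κ ⊓ (g ∸ j))
      ≡⟨ cong₂ (λ a b → (a + κ) ⊓ (b + κ ⊓ (g ∸ j))) (m≥n⇒m⊓n≡n E≤α) (m≥n⇒m⊓n≡n (≤-trans E≤α (m≤m+n α γ))) ⟩
    (E + κ) ⊓ (E + κ ⊓ (g ∸ j))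
      ≡⟨ cong (λ d → (E + κ) ⊓ (E + κ ⊓ d)) (m≤n⇒m∸n≡0 (≤-trans (m≤n+m g γ) γ+g≤j)) ⟩
    (E + κ) ⊓ (E + κ ⊓ 0)     ≡⟨ cong (λ t → (E + κ) ⊓ (E + t)) (⊓-zeroʳ κ) ⟩
    (E + κ) ⊓ (E + 0)         ≡⟨ m≥n⇒m⊓n≡n (+-monoʳ-≤ E z≤n) ⟩
    E + 0                     ≡⟨ +-identityʳ E ⟩
    E                         ∎

z+[t+j]⊓[t+g]≡[d+k+[t+j]]⊓[t+d+g]⇒z≡d+k⊓[g∸j] : ∀ {z} t j g d k →
  z + (t + j) ⊓ (t + g) ≡ ((d + k) + (t + j)) ⊓ ((t + d) + g) → z ≡ d + k ⊓ (g ∸ j)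
z+[t+j]⊓[t+g]≡[d+k+[t+j]]⊓[t+d+g]⇒z≡d+k⊓[g∸j] {z} t j g d k eq =
  +-cancelʳ-≡ (t + j ⊓ g) z (d + k ⊓ (g ∸ j)) (begin
  z + (t + j ⊓ g)                     ≡⟨ cong (z +_) (+-distribˡ-⊓ t j g) ⟩
  z + (t + j) ⊓ (t + g)               ≡⟨ eq ⟩
  ((d + k) + (t + j)) ⊓ ((t + d) + g) ≡⟨ cong (_⊓ ((t + d) + g)) (interchange d k t j) ⟩
  ((d + t) + (k + j)) ⊓ ((t + d) + g) ≡⟨ cong (λ w → (w + (k + j)) ⊓ ((t + d) + g)) (+-comm d t) ⟩
  ((t + d) + (k + j)) ⊓ ((t + d) + g) ≡⟨ sym (+-distribˡ-⊓ (t + d) (k + j) g) ⟩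
  (t + d) + (k + j) ⊓ g               ≡⟨ cong (λ m → (t + d) + m ⊓ g) (+-comm k j) ⟩
  (t + d) + (j + k) ⊓ g               ≡⟨ cong ((t + d) +_) ([m+n]⊓o≡m⊓o+n⊓[o∸m] j k g) ⟩
  (t + d) + (j ⊓ g + k ⊓ (g ∸ j))     ≡⟨ interchange t d (j ⊓ g) (k ⊓ (g ∸ j)) ⟩
  (t + j ⊓ g) + (d + k ⊓ (g ∸ j))     ≡⟨ +-comm (t + j ⊓ g) (d + k ⊓ (g ∸ j)) ⟩
  d + k ⊓ (g ∸ j) + (t + j ⊓ g)       ∎)
  where open ≡-Reasoning

-- Read a = ρ_M(I_S ∪ U_S), b = ρ_M(U_S), c = ρ_M(V_S), R = ρ(M), u = |U_T|, t₀ = ρ_N(U_T),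
-- t₁ = ρ_N(I_T ∪ U_T), q = |I_T|, where X_S = X ∩ S and X_T = X ∩ T; the last three
-- hypotheses determine x = ρ_M′(I_S), y = ρ(M′) and z = ρ_N′(I_T).
rank-identity : ∀ {R c a b u t₀ t₁ q x y z} →
  b ≤ a → a ≤ c → c ≤ R → t₀ ≤ u → t₀ ≤ t₁ → t₁ ≤ q + t₀ →
  x + b ⊓ (R ∸ (u ∸ t₀)) ≡ a ⊓ (R ∸ (u ∸ t₀)) →
  y + b ⊓ (R ∸ (u ∸ t₀)) ≡ c ⊓ (R ∸ (u ∸ t₀)) →
  z + u ⊓ (t₀ + (R ∸ c)) ≡ (q + u) ⊓ (t₁ + (R ∸ c)) →
  (a + (q + u)) ⊓ (R + t₁) ≡ (x + q) ⊓ (y + z) + (b + u) ⊓ (R + t₀)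
rank-identity {b = b} {t₀ = t₀} {q = q} {x = x} {y} {z} b≤a a≤c c≤R t₀≤u t₀≤t₁ t₁≤q+t₀ hx hy hz
  with m≤n⇒∃[o]m+o≡n b≤a | m≤n⇒∃[o]m+o≡n a≤c | m≤n⇒∃[o]m+o≡n c≤R
     | m≤n⇒∃[o]m+o≡n t₀≤u | m≤n⇒∃[o]m+o≡n t₀≤t₁
... | α , refl | γ , refl | g , refl | j , refl | δ , refl
  with m≤n⇒∃[o]m+o≡n (+-cancelʳ-≤ t₀ δ q (subst (_≤ q + t₀) (+-comm t₀ δ) t₁≤q+t₀))
... | κ , refl = begin
  (b + α + ((δ + κ) + (t₀ + j))) ⊓ (b + α + γ + g + (t₀ + δ))
    ≡⟨ cong₂ _⊓_ (regroup₁ b α δ κ t₀ j) (regroup₂ b α γ g t₀ δ) ⟩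
  (b + t₀ + δ + (α + (κ + j))) ⊓ (b + t₀ + δ + (α + (γ + g)))
    ≡⟨ sym (+-distribˡ-⊓ (b + t₀ + δ) _ _) ⟩
  b + t₀ + δ + (α + (κ + j)) ⊓ (α + (γ + g))
    ≡⟨ cong (b + t₀ + δ +_) (sym (+-distribˡ-⊓ α (κ + j) (γ + g))) ⟩
  b + t₀ + δ + (α + (κ + j) ⊓ (γ + g))
    ≡⟨ cong (b + t₀ + δ +_) (rank-identity-core α γ g j κ) ⟩
  b + t₀ + δ + (Min + j ⊓ W)
    ≡⟨ regroup₄ b t₀ δ Min (j ⊓ W) ⟩
  (δ + Min) + (b + t₀ + j ⊓ W)
    ≡⟨ cong₂ _+_ δ+Min≡ (sym t-part≡) ⟩
  (x + (δ + κ)) ⊓ (y + z) + (b + (t₀ + j)) ⊓ (b + α + γ + g + t₀) ∎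
  where
  open ≡-Reasoning
  W E : ℕ
  W = α + γ + g
  E = W ∸ j
  Min : ℕ
  Min = (α ⊓ E + κ) ⊓ ((α + γ) ⊓ E + κ ⊓ (g ∸ j))
  regroup₁ : ∀ b α δ κ t₀ j → b + α + ((δ + κ) + (t₀ + j)) ≡ b + t₀ + δ + (α + (κ + j))
  regroup₁ = solve-∀
  regroup₂ : ∀ b α γ g t₀ δ → b + α + γ + g + (t₀ + δ) ≡ b + t₀ + δ + (α + (γ + g))
  regroup₂ = solve-∀
  regroup₃ : ∀ b α γ g t₀ → b + α + γ + g + t₀ ≡ b + t₀ + (α + γ + g)
  regroup₃ = solve-∀
  regroup₄ : ∀ b t d m J → b + t + d + (m + J) ≡ (d + m) + (b + t + J)
  regroup₄ = solve-∀
  b+α+γ+g≡b+W : b + α + γ + g ≡ b + W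
  b+α+γ+g≡b+W = trans (cong (_+ g) (+-assoc b α γ)) (+-assoc b (α + γ) g)
  D : ℕ
  D = b + α + γ + g ∸ (t₀ + j ∸ t₀)
  D∸b≡E : D ∸ b ≡ E
  D∸b≡E = begin
    b + α + γ + g ∸ (t₀ + j ∸ t₀) ∸ b ≡⟨ cong (λ k → b + α + γ + g ∸ k ∸ b) (m+n∸m≡n t₀ j) ⟩
    b + α + γ + g ∸ j ∸ b             ≡⟨ ∸-+-assoc (b + α + γ + g) j b ⟩
    b + α + γ + g ∸ (j + b)           ≡⟨ cong₂ _∸_ b+α+γ+g≡b+W (+-comm j b) ⟩
    b + W ∸ (b + j)                   ≡⟨ [m+n]∸[m+o]≡n∸o b W j ⟩
    E                                 ∎
  x≡ : x ≡ α ⊓ E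
  x≡ = trans (x+m⊓o≡[m+n]⊓o⇒x≡n⊓[o∸m] b α D hx) (cong (α ⊓_) D∸b≡E)
  y≡ : y ≡ (α + γ) ⊓ E
  y≡ = trans (x+m⊓o≡[m+n]⊓o⇒x≡n⊓[o∸m] b (α + γ) D (trans hy (cong (_⊓ D) (+-assoc b α γ))))
             (cong ((α + γ) ⊓_) D∸b≡E)
  z≡ : z ≡ δ + κ ⊓ (g ∸ j)
  z≡ = z+[t+j]⊓[t+g]≡[d+k+[t+j]]⊓[t+d+g]⇒z≡d+k⊓[g∸j] t₀ j g δ κ
         (subst (λ g′ → z + (t₀ + j) ⊓ (t₀ + g′) ≡ (δ + κ + (t₀ + j)) ⊓ (t₀ + δ + g′))
                (m+n∸m≡n (b + α + γ) g) hz)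
  δ+Min≡ : δ + Min ≡ (x + (δ + κ)) ⊓ (y + z)
  δ+Min≡ = begin
    δ + Min
      ≡⟨ +-distribˡ-⊓ δ _ _ ⟩
    (δ + (α ⊓ E + κ)) ⊓ (δ + ((α + γ) ⊓ E + κ ⊓ (g ∸ j)))
      ≡⟨ cong₂ _⊓_ (x∙yz≈y∙xz δ (α ⊓ E) κ) (x∙yz≈y∙xz δ ((α + γ) ⊓ E) (κ ⊓ (g ∸ j))) ⟩
    (α ⊓ E + (δ + κ)) ⊓ ((α + γ) ⊓ E + (δ + κ ⊓ (g ∸ j)))
      ≡⟨ sym (cong₂ (λ x′ y′ → (x′ + (δ + κ)) ⊓ (y′ + (δ + κ ⊓ (g ∸ j)))) x≡ y≡) ⟩
    (x + (δ + κ)) ⊓ (y + (δ + κ ⊓ (g ∸ j)))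
      ≡⟨ cong (λ z′ → (x + (δ + κ)) ⊓ (y + z′)) (sym z≡) ⟩
    (x + (δ + κ)) ⊓ (y + z)
      ∎
  t-part≡ : (b + (t₀ + j)) ⊓ (b + α + γ + g + t₀) ≡ b + t₀ + j ⊓ W
  t-part≡ = trans (cong₂ _⊓_ (sym (+-assoc b t₀ j)) (regroup₃ b α γ g t₀))
                  (sym (+-distribˡ-⊓ (b + t₀) j W))

-- Rank of a set system

maxℕ-upper : ∀ {m} ms → m ∈ₗ ms → m ≤ maxℕ ms
maxℕ-upper (m List.∷ ms) (Any.here refl)  = m≤m⊔n m (maxℕ ms)
maxℕ-upper (m List.∷ ms) (Any.there m∈ms) = ≤-trans (maxℕ-upper ms m∈ms) (m≤n⊔m m (maxℕ ms))

maxℕ-least : ∀ {k} ms → (∀ {m} → m ∈ₗ ms → m ≤ k) → maxℕ ms ≤ k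
maxℕ-least List.[]        _     = z≤n
maxℕ-least (m List.∷ ms) ms≤k = ⊔-lub (ms≤k (Any.here refl)) (maxℕ-least ms (ms≤k ∘ Any.there))

maxℕ-attained : ∀ ms → maxℕ ms ≡ 0 ⊎ maxℕ ms ∈ₗ ms
maxℕ-attained List.[]        = inj₁ refl
maxℕ-attained (m List.∷ ms) with ≤-total m (maxℕ ms) | maxℕ-attained ms
... | inj₁ m≤max | inj₁ max≡0  = inj₁ (trans (m≤n⇒m⊔n≡n m≤max) max≡0)
... | inj₁ m≤max | inj₂ max∈ms = inj₂ (subst (_∈ₗ m List.∷ ms) (sym (m≤n⇒m⊔n≡n m≤max)) (Any.there max∈ms))
... | inj₂ max≤m | _           = inj₂ (subst (_∈ₗ m List.∷ ms) (sym (m≥n⇒m⊔n≡m max≤m)) (Any.here refl))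

∈-allSubsets : ∀ (p : Subset n) → p ∈ₗ allSubsets n
∈-allSubsets []          = Any.here refl
∈-allSubsets (false ∷ p) = ∈-++⁺ˡ (∈-map⁺ (false ∷_) (∈-allSubsets p))
∈-allSubsets (true  ∷ p) = ∈-++⁺ʳ (List.map (false ∷_) (allSubsets _)) (∈-map⁺ (true ∷_) (∈-allSubsets p))

IsBasis : SetSystem n → Subset n → Subset n → Set
IsBasis Q X B = B ⊆ X × Indep Q B × ∣ B ∣ ≡ rank Q X

module _ (Q : SetSystem n) where

  private
    indepIn? : ∀ X → Decidable (λ B → B ⊆ X × Indep Q B)
    indepIn? X B = (B ⊆? X) ×-dec indep? Q B

    sizes : Subset n → List ℕ
    sizes X = List.map ∣_∣ (List.filter (indepIn? X) (allSubsets n))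

  rank-upper : A ⊆ X → Indep Q A → ∣ A ∣ ≤ rank Q X
  rank-upper {A = A} {X = X} A⊆X A∈Q = maxℕ-upper (sizes X)
    (∈-map∘filter⁺ ∣_∣ (indepIn? X) (A , ∈-allSubsets A , refl , A⊆X , A∈Q))

  rank-least : ∀ {k} → (∀ A → A ⊆ X → Indep Q A → ∣ A ∣ ≤ k) → rank Q X ≤ k
  rank-least {X = X} {k} bound = maxℕ-least (sizes X) λ m∈ →
    let (A , _ , m≡∣A∣ , A⊆X , A∈Q) = ∈-map∘filter⁻ ∣_∣ (indepIn? X) {xs = allSubsets n} m∈
    in subst (_≤ k) (sym m≡∣A∣) (bound A A⊆X A∈Q)

  basis-exists : Indep Q ⊥ → ∀ X → ∃ (IsBasis Q X)
  basis-exists ⊥∈Q X with maxℕ-attained (sizes X)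
  ... | inj₁ rank≡0 = ⊥ , ⊥⊆ , ⊥∈Q , trans (∣⊥∣≡0 n) (sym rank≡0)
  ... | inj₂ rank∈  with ∈-map∘filter⁻ ∣_∣ (indepIn? X) {xs = allSubsets n} rank∈
  ...   | B , _ , rank≡∣B∣ , B⊆X , B∈Q = B , B⊆X , B∈Q , sym rank≡∣B∣

  rank-mono : X ⊆ Y → rank Q X ≤ rank Q Y
  rank-mono X⊆Y = rank-least λ A A⊆X A∈Q → rank-upper (⊆-trans A⊆X X⊆Y) A∈Q

  rank≤∣∣ : ∀ X → rank Q X ≤ ∣ X ∣
  rank≤∣∣ X = rank-least λ A A⊆X _ → p⊆q⇒∣p∣≤∣q∣ A⊆X

  indep⇒rank≡∣∣ : Indep Q A → rank Q A ≡ ∣ A ∣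
  indep⇒rank≡∣∣ {A = A} A∈Q = ≤-antisym (rank≤∣∣ A) (rank-upper ⊆-refl A∈Q)

rank-cong : ∀ {Q Q′ : SetSystem n} → (∀ A → Indep Q A ⇔ Indep Q′ A) → ∀ X → rank Q X ≡ rank Q′ X
rank-cong {Q = Q} {Q′} Q⇔Q′ X = ≤-antisym
  (rank-least Q λ A A⊆X A∈Q → rank-upper Q′ A⊆X (Equivalence.to (Q⇔Q′ A) A∈Q))
  (rank-least Q′ λ A A⊆X A∈Q′ → rank-upper Q A⊆X (Equivalence.from (Q⇔Q′ A) A∈Q′))

rank-restrict : ∀ (Q : SetSystem n) → X ⊆ V → rank (restrict Q V) X ≡ rank Q X
rank-restrict {V = V} Q X⊆V = ≤-antisym
  (rank-least (restrict Q V) λ A A⊆X (A∈Q , _) → rank-upper Q A⊆X A∈Q)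
  (rank-least Q λ A A⊆X A∈Q → rank-upper (restrict Q V) A⊆X (A∈Q , ⊆-trans A⊆X X⊆V))

-- Matroids

module _ {Q : SetSystem n} (Q-mat : IsMatroid Q) where
  open IsMatroid Q-mat

  rank≤rk : ∀ X → rank Q X ≤ rk Q
  rank≤rk X = rank-least Q λ A _ A∈Q → rank-upper Q (indep-ground A A∈Q) A∈Q

  rank-∪≤ : ∀ X Y → rank Q (X ∪ Y) ≤ ∣ X ∣ + rank Q Y
  rank-∪≤ X Y = rank-least Q λ A A⊆X∪Y A∈Q → begin
    ∣ A ∣                 ≡⟨ ∣p∣≡∣p∩q∣+∣p─q∣ A Y ⟩
    ∣ A ∩ Y ∣ + ∣ A ─ Y ∣ ≤⟨ +-mono-≤ (rank-upper Q (p∩q⊆q A Y) (indep-hered _ A (p∩q⊆p A Y) A∈Q))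
                                      (p⊆q⇒∣p∣≤∣q∣ (p⊆q∪r⇒p─r⊆q A X Y A⊆X∪Y)) ⟩
    rank Q Y + ∣ X ∣      ≡⟨ +-comm (rank Q Y) ∣ X ∣ ⟩
    ∣ X ∣ + rank Q Y      ∎
    where open ≤-Reasoning

  basis-extend : Indep Q A → A ⊆ Y → ∃ λ B → A ⊆ B × IsBasis Q Y B
  basis-extend {A = A} {Y = Y} A∈Q A⊆Y = go (rank Q Y) A A∈Q A⊆Y (m≤m+n (rank Q Y) ∣ A ∣)
    where
    go : ∀ k A → Indep Q A → A ⊆ Y → rank Q Y ≤ k + ∣ A ∣ → ∃ λ B → A ⊆ B × IsBasis Q Y B
    go k A A∈Q A⊆Y _ with ∣ A ∣ <? rank Q Y
    ... | no ∣A∣≮rank = A , ⊆-refl , A⊆Y , A∈Q , ≤-antisym (rank-upper Q A⊆Y A∈Q) (≮⇒≥ ∣A∣≮rank)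
    go zero A _ _ rank≤∣A∣ | yes ∣A∣<rank = ⊥-elim (<⇒≱ ∣A∣<rank rank≤∣A∣)
    go (suc k) A A∈Q A⊆Y rank≤ | yes ∣A∣<rank with basis-exists Q indep-empty Y
    ... | W , W⊆Y , W∈Q , ∣W∣ with indep-aug A W A∈Q W∈Q (subst (∣ A ∣ <_) (sym ∣W∣) ∣A∣<rank)
    ... | x , x∈W , x∉A , A+x∈Q
      with go k (A ∪ ⁅ x ⁆) A+x∈Q (∪-least A⊆Y (x∈p⇒⁅x⁆⊆p (W⊆Y x∈W)))
              (subst (rank Q Y ≤_) (sym (trans (cong (k +_) (∣p∪⁅x⁆∣≡1+∣p∣ A x∉A)) (+-suc k ∣ A ∣))) rank≤)
    ... | B , A+x⊆B , B-basis = B , ⊆-trans (p⊆p∪q ⁅ x ⁆) A+x⊆B , B-basis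

  rank≡∣∣⇒indep : rank Q X ≡ ∣ X ∣ → Indep Q X
  rank≡∣∣⇒indep {X = X} rank≡∣X∣ with basis-exists Q indep-empty X
  ... | B , B⊆X , B∈Q , ∣B∣ =
    indep-hered X B (p⊆q∧∣q∣≤∣p∣⇒q⊆p B⊆X (≤-reflexive (sym (trans ∣B∣ rank≡∣X∣)))) B∈Q

  -- If a basis B of X ∪ A extends a basis of A, then B ─ A is independent in Q / A.
  rank-contract : X ⊆ ground Q ─ A → rank (contract Q A) X + rank Q A ≡ rank Q (X ∪ A)
  rank-contract {X = X} {A = A} X⊆E─A = ≤-antisym upper lower
    where
    open ≤-Reasoning
    upper : rank (contract Q A) X + rank Q A ≤ rank Q (X ∪ A)
    upper = begin
      rank (contract Q A) X + rank Q A      ≤⟨ +-monoˡ-≤ (rank Q A) (rank-least (contract Q A) bound) ⟩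
      rank Q (X ∪ A) ∸ rank Q A + rank Q A  ≡⟨ m∸n+n≡m (rank-mono Q (q⊆p∪q X A)) ⟩
      rank Q (X ∪ A)                        ∎
      where
      bound : ∀ I → I ⊆ X → Indep (contract Q A) I → ∣ I ∣ ≤ rank Q (X ∪ A) ∸ rank Q A
      bound I I⊆X (_ , rank≡) = m+n≤o⇒m≤o∸n ∣ I ∣
        (subst (_≤ rank Q (X ∪ A)) rank≡ (rank-mono Q (∪-least (⊆-trans I⊆X (p⊆p∪q A)) (q⊆p∪q X A))))
    lower : rank Q (X ∪ A) ≤ rank (contract Q A) X + rank Q A
    lower with basis-exists Q indep-empty A
    ... | W , W⊆A , W∈Q , ∣W∣ with basis-extend W∈Q (⊆-trans W⊆A (q⊆p∪q X A))
    ... | B , W⊆B , B⊆X∪A , B∈Q , ∣B∣ = begin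
      rank Q (X ∪ A)                    ≡⟨ sym ∣B─A∣+rank≡ ⟩
      ∣ B ─ A ∣ + rank Q A              ≤⟨ +-monoˡ-≤ (rank Q A) (rank-upper (contract Q A) B─A⊆X B─A∈Q/A) ⟩
      rank (contract Q A) X + rank Q A  ∎
      where
      B─A⊆X : B ─ A ⊆ X
      B─A⊆X = p⊆q∪r⇒p─r⊆q B X A B⊆X∪A
      ∣B∩A∣≡rank : ∣ B ∩ A ∣ ≡ rank Q A
      ∣B∩A∣≡rank = ≤-antisym (rank-upper Q (p∩q⊆q B A) (indep-hered _ B (p∩q⊆p B A) B∈Q))
                             (subst (_≤ ∣ B ∩ A ∣) ∣W∣ (p⊆q⇒∣p∣≤∣q∣ (∩-greatest W⊆B W⊆A)))
      ∣B─A∣+rank≡ : ∣ B ─ A ∣ + rank Q A ≡ rank Q (X ∪ A)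
      ∣B─A∣+rank≡ = trans (+-comm ∣ B ─ A ∣ (rank Q A))
        (trans (cong (_+ ∣ B ─ A ∣) (sym ∣B∩A∣≡rank)) (trans (sym (∣p∣≡∣p∩q∣+∣p─q∣ B A)) ∣B∣))
      B─A∈Q/A : Indep (contract Q A) (B ─ A)
      B─A∈Q/A = ⊆-trans B─A⊆X X⊆E─A , trans rank≡ (sym ∣B─A∣+rank≡)
        where
        rank≡ : rank Q ((B ─ A) ∪ A) ≡ rank Q (X ∪ A)
        rank≡ = ≤-antisym (rank-mono Q (∪-least (⊆-trans B─A⊆X (p⊆p∪q A)) (q⊆p∪q X A)))
                          (subst (_≤ rank Q ((B ─ A) ∪ A)) ∣B∣ (rank-upper Q (p⊆[p─q]∪q B A) B∈Q))

  contract-indep⇔ : X ⊆ ground Q ─ A → Indep (contract Q A) X ⇔ (rank (contract Q A) X ≡ ∣ X ∣)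
  contract-indep⇔ {X = X} {A = A} X⊆E─A = mk⇔
    (λ (_ , rank≡) → +-cancelʳ-≡ (rank Q A) _ _ (trans (rank-contract X⊆E─A) rank≡))
    (λ rank≡∣X∣ → (λ {_} → X⊆E─A) , trans (sym (rank-contract X⊆E─A)) (cong (_+ rank Q A) rank≡∣X∣))

-- Restriction, truncation and lift

restrict-isMatroid : ∀ {Q : SetSystem n} V → IsMatroid Q → IsMatroid (restrict Q V)
restrict-isMatroid V Q-mat = record
  { indep-ground = λ A (A∈Q , A⊆V) → ∩-greatest (indep-ground A A∈Q) A⊆V
  ; indep-empty  = indep-empty , ⊥⊆
  ; indep-hered  = λ A B A⊆B (B∈Q , B⊆V) → indep-hered A B A⊆B B∈Q , ⊆-trans A⊆B B⊆V
  ; indep-aug    = λ A B (A∈Q , A⊆V) (B∈Q , B⊆V) ∣A∣<∣B∣ →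
      let x , x∈B , x∉A , A+x∈Q = indep-aug A B A∈Q B∈Q ∣A∣<∣B∣
      in  x , x∈B , x∉A , A+x∈Q , ∪-least A⊆V (x∈p⇒⁅x⁆⊆p (B⊆V x∈B))
  }
  where open IsMatroid Q-mat

isMatroid-resp-≅ : ∀ {Q Q′ : SetSystem n} → Q ≅ Q′ → IsMatroid Q → IsMatroid Q′
isMatroid-resp-≅ {Q = Q} {Q′} (E≡E′ , Q⇔Q′) Q-mat = record
  { indep-ground = λ A A∈Q′ → subst (A ⊆_) E≡E′ (indep-ground A (from A A∈Q′))
  ; indep-empty  = to _ indep-empty
  ; indep-hered  = λ A B A⊆B B∈Q′ → to A (indep-hered A B A⊆B (from B B∈Q′))
  ; indep-aug    = λ A B A∈Q′ B∈Q′ ∣A∣<∣B∣ →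
      let x , x∈B , x∉A , A+x∈Q = indep-aug A B (from A A∈Q′) (from B B∈Q′) ∣A∣<∣B∣
      in  x , x∈B , x∉A , to _ A+x∈Q
  }
  where
  open IsMatroid Q-mat
  to : ∀ A → Indep Q A → Indep Q′ A
  to A = Equivalence.to (Q⇔Q′ A)
  from : ∀ A → Indep Q′ A → Indep Q A
  from A = Equivalence.from (Q⇔Q′ A)

≅-sym : ∀ {Q Q′ : SetSystem n} → Q ≅ Q′ → Q′ ≅ Q
≅-sym (E≡E′ , Q⇔Q′) = sym E≡E′ , λ A → ⇔-sym (Q⇔Q′ A)

ground-iter : ∀ (f : SetSystem n → SetSystem n) → (∀ Q → ground (f Q) ≡ ground Q) →
              ∀ k Q → ground (iter f k Q) ≡ ground Q
ground-iter f ground-f zero    Q = refl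
ground-iter f ground-f (suc k) Q = trans (ground-f (iter f k Q)) (ground-iter f ground-f k Q)

module _ {Q : SetSystem n} (Q-mat : IsMatroid Q) where
  open IsMatroid Q-mat

  rank-truncation : ∀ X → rank (truncation Q) X ≡ rank Q X ⊓ (rk Q ∸ 1)
  rank-truncation X = ≤-antisym
    (rank-least (truncation Q) λ A A⊆X (A∈Q , ∣A∣≤) → ⊓-glb (rank-upper Q A⊆X A∈Q) ∣A∣≤)
    lower
    where
    lower : rank Q X ⊓ (rk Q ∸ 1) ≤ rank (truncation Q) X
    lower with basis-exists Q indep-empty X
    ... | W , W⊆X , W∈Q , ∣W∣ with ∃-⊆-of-size W (∣ W ∣ ⊓ (rk Q ∸ 1)) (m⊓n≤m _ _)
    ... | C , C⊆W , ∣C∣ = subst (_≤ rank (truncation Q) X) (trans ∣C∣ (cong (_⊓ (rk Q ∸ 1)) ∣W∣))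
      (rank-upper (truncation Q) (⊆-trans C⊆W W⊆X)
        (indep-hered C W C⊆W W∈Q , subst (_≤ rk Q ∸ 1) (sym ∣C∣) (m⊓n≤n _ _)))

  truncation-isMatroid : IsMatroid (truncation Q)
  truncation-isMatroid = record
    { indep-ground = λ A (A∈Q , _) → indep-ground A A∈Q
    ; indep-empty  = indep-empty , subst (_≤ rk Q ∸ 1) (sym (∣⊥∣≡0 n)) z≤n
    ; indep-hered  = λ A B A⊆B (B∈Q , ∣B∣≤) → indep-hered A B A⊆B B∈Q , ≤-trans (p⊆q⇒∣p∣≤∣q∣ A⊆B) ∣B∣≤
    ; indep-aug    = λ A B (A∈Q , _) (B∈Q , ∣B∣≤) ∣A∣<∣B∣ →
        let x , x∈B , x∉A , A+x∈Q = indep-aug A B A∈Q B∈Q ∣A∣<∣B∣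
        in  x , x∈B , x∉A , A+x∈Q , subst (_≤ rk Q ∸ 1) (sym (∣p∪⁅x⁆∣≡1+∣p∣ A x∉A)) (≤-trans ∣A∣<∣B∣ ∣B∣≤)
    }

truncation^-isMatroid : ∀ {Q : SetSystem n} j → IsMatroid Q → IsMatroid (truncation^ j Q)
truncation^-isMatroid zero    Q-mat = Q-mat
truncation^-isMatroid (suc j) Q-mat = truncation-isMatroid (truncation^-isMatroid j Q-mat)

rank-truncation^ : ∀ {Q : SetSystem n} → IsMatroid Q →
                   ∀ j X → rank (truncation^ j Q) X ≡ rank Q X ⊓ (rk Q ∸ j)
rank-truncation^ Q-mat zero X = sym (m≤n⇒m⊓n≡m (rank≤rk Q-mat X))
rank-truncation^ {Q = Q} Q-mat (suc j) X = begin
  rank (truncation (truncation^ j Q)) X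
    ≡⟨ rank-truncation (truncation^-isMatroid j Q-mat) X ⟩
  rank (truncation^ j Q) X ⊓ (rk (truncation^ j Q) ∸ 1)
    ≡⟨ cong₂ (λ a b → a ⊓ (b ∸ 1)) (rank-truncation^ Q-mat j X) rk≡ ⟩
  (rank Q X ⊓ (rk Q ∸ j)) ⊓ (rk Q ∸ j ∸ 1)
    ≡⟨ ⊓-assoc (rank Q X) _ _ ⟩
  rank Q X ⊓ ((rk Q ∸ j) ⊓ (rk Q ∸ j ∸ 1))
    ≡⟨ cong (rank Q X ⊓_) (m≥n⇒m⊓n≡n (m∸n≤m (rk Q ∸ j) 1)) ⟩
  rank Q X ⊓ (rk Q ∸ j ∸ 1)
    ≡⟨ cong (rank Q X ⊓_) (trans (∸-+-assoc (rk Q) j 1) (cong (rk Q ∸_) (+-comm j 1))) ⟩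
  rank Q X ⊓ (rk Q ∸ suc j)
    ∎
  where
  open ≡-Reasoning
  rk≡ : rk (truncation^ j Q) ≡ rk Q ∸ j
  rk≡ = begin
    rank (truncation^ j Q) (ground (truncation^ j Q))
      ≡⟨ cong (rank (truncation^ j Q)) (ground-iter truncation (λ _ → refl) j Q) ⟩
    rank (truncation^ j Q) (ground Q)                 ≡⟨ rank-truncation^ Q-mat j (ground Q) ⟩
    rk Q ⊓ (rk Q ∸ j)                                 ≡⟨ m≥n⇒m⊓n≡n (m∸n≤m (rk Q) j) ⟩
    rk Q ∸ j                                          ∎

liftBy : ℕ → SetSystem n → SetSystem n
liftBy k N = record
  { ground = ground N
  ; Indep  = λ A → A ⊆ ground N × nullity N A ≤ k
  ; indep? = λ A → (A ⊆? ground N) ×-dec (nullity N A ≤? k)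
  }

module _ {N : SetSystem n} (N-mat : IsMatroid N) where
  open IsMatroid N-mat

  nullity-mono : A ⊆ B → nullity N A ≤ nullity N B
  nullity-mono {A = A} {B = B} A⊆B = begin
    ∣ A ∣ ∸ rank N A                             ≡⟨ sym ([m+n]∸[m+o]≡n∸o ∣ B ─ A ∣ ∣ A ∣ (rank N A)) ⟩
    (∣ B ─ A ∣ + ∣ A ∣) ∸ (∣ B ─ A ∣ + rank N A) ≤⟨ ∸-monoʳ-≤ _ rank-B≤ ⟩
    (∣ B ─ A ∣ + ∣ A ∣) ∸ rank N B               ≡⟨ cong (_∸ rank N B) ∣B─A∣+∣A∣≡∣B∣ ⟩
    ∣ B ∣ ∸ rank N B                             ∎
    where
    open ≤-Reasoning
    rank-B≤ : rank N B ≤ ∣ B ─ A ∣ + rank N A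
    rank-B≤ = ≤-trans (rank-mono N (p⊆[p─q]∪q B A)) (rank-∪≤ N-mat (B ─ A) A)
    ∣B─A∣+∣A∣≡∣B∣ : ∣ B ─ A ∣ + ∣ A ∣ ≡ ∣ B ∣
    ∣B─A∣+∣A∣≡∣B∣ = trans (+-comm ∣ B ─ A ∣ ∣ A ∣) (trans
      (cong (λ C → ∣ C ∣ + ∣ B ─ A ∣) (sym (trans (∩-comm B A) (p⊆q⇒p∩q≡p A⊆B))))
      (sym (∣p∣≡∣p∩q∣+∣p─q∣ B A)))

  nullity-∪⁅x⁆≤ : x ∉ A → nullity N (A ∪ ⁅ x ⁆) ≤ suc (nullity N A)
  nullity-∪⁅x⁆≤ {x = x} {A = A} x∉A = begin
    ∣ A ∪ ⁅ x ⁆ ∣ ∸ rank N (A ∪ ⁅ x ⁆) ≤⟨ ∸-monoʳ-≤ _ (rank-mono N (p⊆p∪q ⁅ x ⁆)) ⟩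
    ∣ A ∪ ⁅ x ⁆ ∣ ∸ rank N A           ≡⟨ cong (_∸ rank N A) (∣p∪⁅x⁆∣≡1+∣p∣ A x∉A) ⟩
    suc ∣ A ∣ ∸ rank N A               ≡⟨ +-∸-assoc 1 (rank≤∣∣ N A) ⟩
    suc (∣ A ∣ ∸ rank N A)             ∎
    where open ≤-Reasoning

  nullity-∪⁅x⁆≤-if-rank-grows : x ∉ A → rank N A < rank N (A ∪ ⁅ x ⁆) →
                                 nullity N (A ∪ ⁅ x ⁆) ≤ nullity N A
  nullity-∪⁅x⁆≤-if-rank-grows {x = x} {A = A} x∉A rank< = begin
    ∣ A ∪ ⁅ x ⁆ ∣ ∸ rank N (A ∪ ⁅ x ⁆) ≤⟨ ∸-monoʳ-≤ _ rank< ⟩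
    ∣ A ∪ ⁅ x ⁆ ∣ ∸ suc (rank N A)     ≡⟨ cong (_∸ suc (rank N A)) (∣p∪⁅x⁆∣≡1+∣p∣ A x∉A) ⟩
    ∣ A ∣ ∸ rank N A                   ∎
    where open ≤-Reasoning

  rank-liftBy : ∀ k → X ⊆ ground N → rank (liftBy k N) X ≡ ∣ X ∣ ⊓ (rank N X + k)
  rank-liftBy {X = X} k X⊆T = ≤-antisym
    (rank-least (liftBy k N) λ B B⊆X (_ , ν≤k) → ⊓-glb (p⊆q⇒∣p∣≤∣q∣ B⊆X)
      (≤-trans (m∸n≤o⇒m≤n+o ∣ B ∣ (rank N B) ν≤k) (+-monoˡ-≤ k (rank-mono N B⊆X))))
    lower
    where
    lower : ∣ X ∣ ⊓ (rank N X + k) ≤ rank (liftBy k N) X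
    lower with basis-exists N indep-empty X
    ... | W , W⊆X , W∈N , ∣W∣ with ⊆-extend W X ((∣ X ∣ ∸ ∣ W ∣) ⊓ k) W⊆X
          (≤-trans (+-monoˡ-≤ ∣ W ∣ (m⊓n≤m _ k)) (≤-reflexive (m∸n+n≡m (p⊆q⇒∣p∣≤∣q∣ W⊆X))))
    ... | C , W⊆C , C⊆X , ∣C∣ = subst (_≤ rank (liftBy k N) X) ∣C∣≡ (rank-upper (liftBy k N) C⊆X C∈L)
      where
      e : ℕ
      e = (∣ X ∣ ∸ ∣ W ∣) ⊓ k
      C∈L : Indep (liftBy k N) C
      C∈L = ⊆-trans C⊆X X⊆T , (begin
        ∣ C ∣ ∸ rank N C   ≤⟨ ∸-monoʳ-≤ ∣ C ∣ (rank-upper N W⊆C W∈N) ⟩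
        ∣ C ∣ ∸ ∣ W ∣       ≡⟨ trans (cong (_∸ ∣ W ∣) ∣C∣) (m+n∸n≡m e ∣ W ∣) ⟩
        e                 ≤⟨ m⊓n≤n _ k ⟩
        k                 ∎)
        where open ≤-Reasoning
      ∣C∣≡ : ∣ C ∣ ≡ ∣ X ∣ ⊓ (rank N X + k)
      ∣C∣≡ = begin
        ∣ C ∣                                          ≡⟨ ∣C∣ ⟩
        e + ∣ W ∣                                      ≡⟨ +-distribʳ-⊓ ∣ W ∣ (∣ X ∣ ∸ ∣ W ∣) k ⟩
        (∣ X ∣ ∸ ∣ W ∣ + ∣ W ∣) ⊓ (k + ∣ W ∣)
          ≡⟨ cong₂ _⊓_ (m∸n+n≡m (p⊆q⇒∣p∣≤∣q∣ W⊆X)) (+-comm k ∣ W ∣) ⟩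
        ∣ X ∣ ⊓ (∣ W ∣ + k)                             ≡⟨ cong (λ w → ∣ X ∣ ⊓ (w + k)) ∣W∣ ⟩
        ∣ X ∣ ⊓ (rank N X + k)                          ∎
        where open ≡-Reasoning

  liftBy-isMatroid : ∀ k → IsMatroid (liftBy k N)
  liftBy-isMatroid k = record
    { indep-ground = λ A (A⊆T , _) → A⊆T
    ; indep-empty  = ⊥⊆ , ≤-trans (m∸n≤m _ (rank N ⊥)) (subst (_≤ k) (sym (∣⊥∣≡0 n)) z≤n)
    ; indep-hered  = λ A B A⊆B (B⊆T , νB≤k) → ⊆-trans A⊆B B⊆T , ≤-trans (nullity-mono A⊆B) νB≤k
    ; indep-aug    = aug
    }
    where
    aug : ∀ A B → Indep (liftBy k N) A → Indep (liftBy k N) B → ∣ A ∣ < ∣ B ∣ →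
          ∃ λ x → x ∈ B × x ∉ A × Indep (liftBy k N) (A ∪ ⁅ x ⁆)
    aug A B (A⊆T , νA≤k) (B⊆T , νB≤k) ∣A∣<∣B∣ with nullity N A <? k
    ... | yes νA<k =
      let x , x∈B , x∉A = ∣p∣<∣q∣⇒∃[x∈q─p] A B ∣A∣<∣B∣
      in  x , x∈B , x∉A , ∪-least A⊆T (x∈p⇒⁅x⁆⊆p (B⊆T x∈B)) , ≤-trans (nullity-∪⁅x⁆≤ x∉A) νA<k
    ... | no νA≮k with basis-exists N indep-empty A | basis-exists N indep-empty B
    ... | WA , WA⊆A , WA∈N , ∣WA∣ | WB , WB⊆B , WB∈N , ∣WB∣
      with indep-aug WA WB WA∈N WB∈N (subst₂ _<_ (sym ∣WA∣) (sym ∣WB∣) rank-A<rank-B)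
      where
      -- A has maximal nullity k, so the extra size of B must come from its rank.
      rank-A<rank-B : rank N A < rank N B
      rank-A<rank-B = +-cancelʳ-< k (rank N A) (rank N B) (begin-strict
        rank N A + k                      ≤⟨ +-monoʳ-≤ (rank N A) (≮⇒≥ νA≮k) ⟩
        rank N A + (∣ A ∣ ∸ rank N A)     ≡⟨ m+[n∸m]≡n (rank≤∣∣ N A) ⟩
        ∣ A ∣                             <⟨ ∣A∣<∣B∣ ⟩
        ∣ B ∣                             ≤⟨ m∸n≤o⇒m≤n+o ∣ B ∣ (rank N B) νB≤k ⟩
        rank N B + k                      ∎)
        where open ≤-Reasoning
    ... | x , x∈WB , x∉WA , WA+x∈N with x ∈? A
    ...   | yes x∈A = ⊥-elim (1+n≰n (begin
              suc (rank N A)       ≡⟨ cong suc (sym ∣WA∣) ⟩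
              suc ∣ WA ∣           ≡⟨ sym (∣p∪⁅x⁆∣≡1+∣p∣ WA x∉WA) ⟩
              ∣ WA ∪ ⁅ x ⁆ ∣       ≤⟨ rank-upper N (∪-least WA⊆A (x∈p⇒⁅x⁆⊆p x∈A)) WA+x∈N ⟩
              rank N A             ∎))
      where open ≤-Reasoning
    ...   | no  x∉A = x , WB⊆B x∈WB , x∉A , ∪-least A⊆T (x∈p⇒⁅x⁆⊆p (B⊆T (WB⊆B x∈WB))) ,
                      ≤-trans (nullity-∪⁅x⁆≤-if-rank-grows x∉A rank-grows) νA≤k
      where
      rank-grows : rank N A < rank N (A ∪ ⁅ x ⁆)
      rank-grows = begin-strict
        rank N A         <⟨ n<1+n (rank N A) ⟩
        suc (rank N A)   ≡⟨ cong suc (sym ∣WA∣) ⟩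
        suc ∣ WA ∣       ≡⟨ sym (∣p∪⁅x⁆∣≡1+∣p∣ WA x∉WA) ⟩
        ∣ WA ∪ ⁅ x ⁆ ∣   ≤⟨ rank-upper N (∪-least (⊆-trans WA⊆A (p⊆p∪q ⁅ x ⁆)) (q⊆p∪q A ⁅ x ⁆)) WA+x∈N ⟩
        rank N (A ∪ ⁅ x ⁆) ∎
        where open ≤-Reasoning

  lift^≅liftBy : ∀ k → lift^ k N ≅ liftBy k N
  rank-lift^ : ∀ k → X ⊆ ground N → rank (lift^ k N) X ≡ ∣ X ∣ ⊓ (rank N X + k)

  lift^≅liftBy zero = refl , λ A → mk⇔
    (λ A∈N → (λ {_} → indep-ground A A∈N) ,
             ≤-reflexive (trans (cong (∣ A ∣ ∸_) (indep⇒rank≡∣∣ N A∈N)) (n∸n≡0 ∣ A ∣)))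
    (λ (_ , ν≤0) → rank≡∣∣⇒indep N-mat (≤-antisym (rank≤∣∣ N A)
                     (subst (∣ A ∣ ≤_) (+-identityʳ (rank N A)) (m∸n≤o⇒m≤n+o ∣ A ∣ (rank N A) ν≤0))))
  lift^≅liftBy (suc k) = ground-iter lift (λ _ → refl) (suc k) N , λ A →
    ⊆×-cong (ground-iter lift (λ _ → refl) k N) λ A⊆T → begin
      (∣ A ∣ ∸ rank (lift^ k N) A ≤ 1)      ≡⟨ cong (λ r → ∣ A ∣ ∸ r ≤ 1) (rank-lift^ k A⊆T) ⟩
      (∣ A ∣ ∸ ∣ A ∣ ⊓ (rank N A + k) ≤ 1)  ≡⟨ cong (_≤ 1) (m∸[m⊓n]≡m∸n ∣ A ∣ (rank N A + k)) ⟩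
      (∣ A ∣ ∸ (rank N A + k) ≤ 1)          ≡⟨ cong (_≤ 1) (sym (∸-+-assoc ∣ A ∣ (rank N A) k)) ⟩
      (∣ A ∣ ∸ rank N A ∸ k ≤ 1)            ∼⟨ m∸n≤1⇔m≤1+n (∣ A ∣ ∸ rank N A) k ⟩
      (∣ A ∣ ∸ rank N A ≤ suc k)            ∎
    where open Related.EquationalReasoning

  rank-lift^ {X = X} k X⊆T =
    trans (rank-cong {Q = lift^ k N} {Q′ = liftBy k N} (proj₂ (lift^≅liftBy k)) X) (rank-liftBy k X⊆T)

  lift^-isMatroid : ∀ k → IsMatroid (lift^ k N)
  lift^-isMatroid k =
    isMatroid-resp-≅ (≅-sym {Q = lift^ k N} {Q′ = liftBy k N} (lift^≅liftBy k)) (liftBy-isMatroid k)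

-- Free products

freeProductRank : SetSystem n → SetSystem n → Subset n → ℕ
freeProductRank M N X = (rank M (X ∩ ground M) + ∣ X ∩ ground N ∣) ⊓ (rk M + rank N (X ∩ ground N))

freeProduct-indep⇔ : ∀ {M N : SetSystem n} → Disjoint (ground M) (ground N) →
  (∀ {X} → X ⊆ ground M → Indep M X ⇔ (rank M X ≡ ∣ X ∣)) →
  ∀ I → Indep (freeProduct M N) I ⇔ (I ⊆ ground M ∪ ground N × freeProductRank M N I ≡ ∣ I ∣)
freeProduct-indep⇔ {n = n} {M = M} {N} S∩T=∅ indep⇔rank I = ⊆×-cong refl λ I⊆S∪T → begin
  (Indep M (I ∩ S) × nullity N (I ∩ T) ≤ corank M (I ∩ S))
    ∼⟨ indep⇔rank (p∩q⊆q I S) ×-⇔ ⇔-id _ ⟩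
  (rank M (I ∩ S) ≡ ∣ I ∩ S ∣ × ∣ I ∩ T ∣ ∸ rank N (I ∩ T) ≤ rk M ∸ rank M (I ∩ S))
    ∼⟨ freeProduct-indep-arith (rank≤∣∣ M (I ∩ S)) (rank-mono M (p∩q⊆q I S)) ⟩
  ((rank M (I ∩ S) + ∣ I ∩ T ∣) ⊓ (rk M + rank N (I ∩ T)) ≡ ∣ I ∩ S ∣ + ∣ I ∩ T ∣)
    ≡⟨ cong (freeProductRank M N I ≡_) (sym (∣p∣≡∣p∩q∣+∣p∩r∣ I S T I⊆S∪T S∩T=∅)) ⟩
  (freeProductRank M N I ≡ ∣ I ∣) ∎
  where
  S T : Subset n
  S = ground M
  T = ground N
  open Related.EquationalReasoning

module _ {M N : SetSystem n} (M-mat : IsMatroid M) (N-mat : IsMatroid N)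
         (S∩T=∅ : Disjoint (ground M) (ground N)) where

  private
    S T : Subset n
    S = ground M
    T = ground N
    R : ℕ
    R = rk M
    P : SetSystem n
    P = freeProduct M N

  rank-freeProduct : ∀ X → rank P X ≡ freeProductRank M N X
  rank-freeProduct X = ≤-antisym (rank-least P upper) lower
    where
    open ≤-Reasoning
    upper : ∀ B → B ⊆ X → Indep P B → ∣ B ∣ ≤ freeProductRank M N X
    upper B B⊆X (B⊆S∪T , B∩S∈M , ν≤λ) = begin
      ∣ B ∣                 ≡⟨ ∣p∣≡∣p∩q∣+∣p∩r∣ B S T B⊆S∪T S∩T=∅ ⟩
      ∣ B ∩ S ∣ + ∣ B ∩ T ∣ ≤⟨ ⊓-glb bound₁ bound₂ ⟩
      freeProductRank M N X ∎
      where
      rank≡∣B∩S∣ : rank M (B ∩ S) ≡ ∣ B ∩ S ∣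
      rank≡∣B∩S∣ = indep⇒rank≡∣∣ M B∩S∈M
      bound₁ : ∣ B ∩ S ∣ + ∣ B ∩ T ∣ ≤ rank M (X ∩ S) + ∣ X ∩ T ∣
      bound₁ = +-mono-≤ (rank-upper M (∩-monoˡ-⊆ S B⊆X) B∩S∈M) (p⊆q⇒∣p∣≤∣q∣ (∩-monoˡ-⊆ T B⊆X))
      bound₂ : ∣ B ∩ S ∣ + ∣ B ∩ T ∣ ≤ R + rank N (X ∩ T)
      bound₂ = ≤-trans
        (Equivalence.from (m+n≤p+o⇔n∸o≤p∸m _ _ _ _ (subst (_≤ R) rank≡∣B∩S∣ (rank≤rk M-mat (B ∩ S))))
          (subst (λ r → ∣ B ∩ T ∣ ∸ rank N (B ∩ T) ≤ R ∸ r) rank≡∣B∩S∣ ν≤λ))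
        (+-monoʳ-≤ R (rank-mono N (∩-monoˡ-⊆ T B⊆X)))
    lower : freeProductRank M N X ≤ rank P X
    lower with basis-exists M (IsMatroid.indep-empty M-mat) (X ∩ S)
             | basis-exists N (IsMatroid.indep-empty N-mat) (X ∩ T)
    ... | WS , WS⊆X∩S , WS∈M , ∣WS∣ | WT , WT⊆X∩T , WT∈N , ∣WT∣
      with ⊆-extend WT (X ∩ T) ((∣ X ∩ T ∣ ∸ ∣ WT ∣) ⊓ (R ∸ ∣ WS ∣)) WT⊆X∩T
             (≤-trans (+-monoˡ-≤ ∣ WT ∣ (m⊓n≤m _ _)) (≤-reflexive (m∸n+n≡m (p⊆q⇒∣p∣≤∣q∣ WT⊆X∩T))))
    ... | C , WT⊆C , C⊆X∩T , ∣C∣ = subst (_≤ rank P X) ∣J∣≡ (rank-upper P J⊆X J∈P)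
      where
      e : ℕ
      e = (∣ X ∩ T ∣ ∸ ∣ WT ∣) ⊓ (R ∸ ∣ WS ∣)
      J : Subset n
      J = WS ∪ C
      WS⊆S : WS ⊆ S
      WS⊆S = ⊆-trans WS⊆X∩S (p∩q⊆q X S)
      C⊆T : C ⊆ T
      C⊆T = ⊆-trans C⊆X∩T (p∩q⊆q X T)
      J⊆X : J ⊆ X
      J⊆X = ∪-least (⊆-trans WS⊆X∩S (p∩q⊆p X S)) (⊆-trans C⊆X∩T (p∩q⊆p X T))
      J∩S⊆WS : J ∩ S ⊆ WS
      J∩S⊆WS = [p∪q]∩r⊆p (disjoint-mono ⊆-refl C⊆T S∩T=∅)
      J∩T⊆C : J ∩ T ⊆ C
      J∩T⊆C = [p∪q]∩r⊆q (disjoint-mono WS⊆S ⊆-refl S∩T=∅)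
      J∩S∈M : Indep M (J ∩ S)
      J∩S∈M = IsMatroid.indep-hered M-mat _ _ J∩S⊆WS WS∈M
      J∈P : Indep P J
      J∈P = ∪-least (⊆-trans WS⊆S (p⊆p∪q T)) (⊆-trans C⊆T (q⊆p∪q S T))
          , J∩S∈M
          , (begin
              nullity N (J ∩ T)        ≤⟨ nullity-mono N-mat J∩T⊆C ⟩
              ∣ C ∣ ∸ rank N C         ≤⟨ ∸-monoʳ-≤ ∣ C ∣ (rank-upper N WT⊆C WT∈N) ⟩
              ∣ C ∣ ∸ ∣ WT ∣           ≡⟨ trans (cong (_∸ ∣ WT ∣) ∣C∣) (m+n∸n≡m e ∣ WT ∣) ⟩
              e                        ≤⟨ m⊓n≤n _ _ ⟩
              R ∸ ∣ WS ∣               ≤⟨ ∸-monoʳ-≤ R (p⊆q⇒∣p∣≤∣q∣ J∩S⊆WS) ⟩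
              R ∸ ∣ J ∩ S ∣            ≡⟨ cong (R ∸_) (sym (indep⇒rank≡∣∣ M J∩S∈M)) ⟩
              corank M (J ∩ S)         ∎)
      ∣J∣≡ : ∣ J ∣ ≡ freeProductRank M N X
      ∣J∣≡ = begin-equality
        ∣ WS ∪ C ∣
          ≡⟨ ∣p∪q∣≡∣p∣+∣q∣ WS C (disjoint-mono WS⊆S C⊆T S∩T=∅) ⟩
        ∣ WS ∣ + ∣ C ∣
          ≡⟨ cong (∣ WS ∣ +_) ∣C∣ ⟩
        ∣ WS ∣ + (e + ∣ WT ∣)
          ≡⟨ cong₂ (λ s t → s + ((∣ X ∩ T ∣ ∸ t) ⊓ (R ∸ s) + t)) ∣WS∣ ∣WT∣ ⟩
        rank M (X ∩ S) + ((∣ X ∩ T ∣ ∸ rank N (X ∩ T)) ⊓ (R ∸ rank M (X ∩ S)) + rank N (X ∩ T))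
          ≡⟨ m+[[n∸o]⊓[p∸m]+o]≡[m+n]⊓[p+o] _ _ _ _ (rank≤rk M-mat (X ∩ S)) (rank≤∣∣ N (X ∩ T)) ⟩
        freeProductRank M N X
          ∎

-- Minors of a free product

ground-minor : ∀ (Q : SetSystem n) E A B → ground Q ≡ E →
               ground (minor Q (A ∩ E) (B ∩ E)) ≡ (B ─ A) ∩ E
ground-minor Q E A B refl = begin
  (E ∩ (B ∩ E)) ─ (A ∩ E) ≡⟨ [p∩q]─r≡[q─r]∩p E (B ∩ E) (A ∩ E) ⟩
  ((B ∩ E) ─ (A ∩ E)) ∩ E ≡⟨ cong (_∩ E) ([p∩r]─[q∩r]≡[p─q]∩r B A E) ⟩
  ((B ─ A) ∩ E) ∩ E       ≡⟨ ∩-assoc (B ─ A) E E ⟩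
  (B ─ A) ∩ (E ∩ E)       ≡⟨ cong ((B ─ A) ∩_) (∩-idem E) ⟩
  (B ─ A) ∩ E             ∎
  where open ≡-Reasoning

module FreeProductMinor {M N : SetSystem n} (M-mat : IsMatroid M) (N-mat : IsMatroid N)
         (S∩T=∅ : Disjoint (ground M) (ground N)) {U V : Subset n} (U⊆V : U ⊆ V) where

  private
    S T : Subset n
    S = ground M
    T = ground N
    P : SetSystem n
    P = freeProduct M N
    j : ℕ
    j = nullity N (U ∩ T)
    i : ℕ
    i = corank M (V ∩ S)
    M₁ : SetSystem n
    M₁ = restrict (truncation^ j M) (V ∩ S)
    N₁ : SetSystem n
    N₁ = restrict (lift^ i N) (V ∩ T)

  M′ N′ : SetSystem n
  M′ = contract M₁ (U ∩ S)
  N′ = contract N₁ (U ∩ T)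

  private
    M₁-mat : IsMatroid M₁
    M₁-mat = restrict-isMatroid (V ∩ S) (truncation^-isMatroid j M-mat)
    N₁-mat : IsMatroid N₁
    N₁-mat = restrict-isMatroid (V ∩ T) (lift^-isMatroid N-mat i)

  ground-M′ : ground M′ ≡ (V ─ U) ∩ S
  ground-M′ = ground-minor (truncation^ j M) S U V (ground-iter truncation (λ _ → refl) j M)

  ground-N′ : ground N′ ≡ (V ─ U) ∩ T
  ground-N′ = ground-minor (lift^ i N) T U V (ground-iter lift (λ _ → refl) i N)

  ground-minor-freeProduct : ground (minor P U V) ≡ ground M′ ∪ ground N′
  ground-minor-freeProduct = begin
    ((S ∪ T) ∩ V) ─ U          ≡⟨ [p∩q]─r≡[q─r]∩p (S ∪ T) V U ⟩
    (V ─ U) ∩ (S ∪ T)          ≡⟨ ∩-distribˡ-∪ (V ─ U) S T ⟩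
    (V ─ U) ∩ S ∪ (V ─ U) ∩ T  ≡⟨ sym (cong₂ _∪_ ground-M′ ground-N′) ⟩
    ground M′ ∪ ground N′      ∎
    where open ≡-Reasoning

  M′∩N′=∅ : Disjoint (ground M′) (ground N′)
  M′∩N′=∅ = subst₂ Disjoint (sym ground-M′) (sym ground-N′)
    (disjoint-mono (p∩q⊆q (V ─ U) S) (p∩q⊆q (V ─ U) T) S∩T=∅)

  M′-indep⇔ : X ⊆ ground M′ → Indep M′ X ⇔ (rank M′ X ≡ ∣ X ∣)
  M′-indep⇔ = contract-indep⇔ M₁-mat

  private
    M′⊆V∩S : ground M′ ⊆ V ∩ S
    M′⊆V∩S = ⊆-trans (p─q⊆p _ (U ∩ S)) (p∩q⊆q _ (V ∩ S))
    N′⊆V∩T : ground N′ ⊆ V ∩ T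
    N′⊆V∩T = ⊆-trans (p─q⊆p _ (U ∩ T)) (p∩q⊆q _ (V ∩ T))

  rank-M′ : X ⊆ ground M′ →
            rank M′ X + rank M (U ∩ S) ⊓ (rk M ∸ j) ≡ rank M (X ∪ U ∩ S) ⊓ (rk M ∸ j)
  rank-M′ {X = X} X⊆M′ = subst₂ (λ l r → rank M′ X + l ≡ r)
    (rank-M₁ (∩-monoˡ-⊆ S U⊆V)) (rank-M₁ (∪-least (⊆-trans X⊆M′ M′⊆V∩S) (∩-monoˡ-⊆ S U⊆V)))
    (rank-contract M₁-mat X⊆M′)
    where
    rank-M₁ : Y ⊆ V ∩ S → rank M₁ Y ≡ rank M Y ⊓ (rk M ∸ j)
    rank-M₁ {Y = Y} Y⊆V∩S = trans (rank-restrict (truncation^ j M) Y⊆V∩S) (rank-truncation^ M-mat j Y)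

  rank-N′ : X ⊆ ground N′ →
            rank N′ X + ∣ U ∩ T ∣ ⊓ (rank N (U ∩ T) + i) ≡ ∣ X ∪ U ∩ T ∣ ⊓ (rank N (X ∪ U ∩ T) + i)
  rank-N′ {X = X} X⊆N′ = subst₂ (λ l r → rank N′ X + l ≡ r)
    (rank-N₁ (∩-monoˡ-⊆ T U⊆V)) (rank-N₁ (∪-least (⊆-trans X⊆N′ N′⊆V∩T) (∩-monoˡ-⊆ T U⊆V)))
    (rank-contract N₁-mat X⊆N′)
    where
    rank-N₁ : Y ⊆ V ∩ T → rank N₁ Y ≡ ∣ Y ∣ ⊓ (rank N Y + i)
    rank-N₁ Y⊆V∩T = trans (rank-restrict (lift^ i N) Y⊆V∩T) (rank-lift^ N-mat i (⊆-trans Y⊆V∩T (p∩q⊆q V T)))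

  M′∪U∩S≡V∩S : ground M′ ∪ U ∩ S ≡ V ∩ S
  M′∪U∩S≡V∩S = begin
    ground M′ ∪ U ∩ S      ≡⟨ cong (_∪ U ∩ S) ground-M′ ⟩
    (V ─ U) ∩ S ∪ U ∩ S    ≡⟨ sym (∩-distribʳ-∪ S (V ─ U) U) ⟩
    ((V ─ U) ∪ U) ∩ S      ≡⟨ cong (_∩ S) (trans ([p─q]∪q≡p∪q V U) (q⊆p⇒p∪q≡p U⊆V)) ⟩
    V ∩ S                  ∎
    where open ≡-Reasoning

  ⊆M′∪N′⇒⊆V─U : X ⊆ ground M′ ∪ ground N′ → X ⊆ V ─ U
  ⊆M′∪N′⇒⊆V─U X⊆M′∪N′ = ⊆-trans X⊆M′∪N′ (subst (_⊆ V ─ U) (sym (cong₂ _∪_ ground-M′ ground-N′))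
                                          (∪-least (p∩q⊆p (V ─ U) S) (p∩q⊆p (V ─ U) T)))

  rank-minor-freeProduct : ∀ {I} → I ⊆ ground M′ ∪ ground N′ →
                           rank P (I ∪ U) ≡ freeProductRank M′ N′ I + rank P U
  rank-minor-freeProduct {I} I⊆G = begin
    rank P (I ∪ U)
      ≡⟨ rank-freeProduct M-mat N-mat S∩T=∅ (I ∪ U) ⟩
    (rank M ((I ∪ U) ∩ S) + ∣ (I ∪ U) ∩ T ∣) ⊓ (rk M + rank N ((I ∪ U) ∩ T))
      ≡⟨ cong₂ (λ A B → (rank M A + ∣ B ∣) ⊓ (rk M + rank N B)) (∩-distribʳ-∪ S I U) (∩-distribʳ-∪ T I U) ⟩
    (rank M (I ∩ S ∪ U ∩ S) + ∣ I ∩ T ∪ U ∩ T ∣) ⊓ (rk M + rank N (I ∩ T ∪ U ∩ T))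
      ≡⟨ cong (λ k → (rank M (I ∩ S ∪ U ∩ S) + k) ⊓ (rk M + rank N (I ∩ T ∪ U ∩ T))) ∣I∩T∪U∩T∣ ⟩
    (rank M (I ∩ S ∪ U ∩ S) + (∣ I ∩ T ∣ + ∣ U ∩ T ∣)) ⊓ (rk M + rank N (I ∩ T ∪ U ∩ T))
      ≡⟨ rank-identity
           (rank-mono M (q⊆p∪q (I ∩ S) (U ∩ S)))
           (rank-mono M (∪-least (∩-monoˡ-⊆ S (⊆-trans I⊆V─U (p─q⊆p V U))) (∩-monoˡ-⊆ S U⊆V)))
           (rank≤rk M-mat (V ∩ S))
           (rank≤∣∣ N (U ∩ T))
           (rank-mono N (q⊆p∪q (I ∩ T) (U ∩ T)))
           (rank-∪≤ N-mat (I ∩ T) (U ∩ T))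
           (rank-M′ I∩S⊆M′)
           (trans (rank-M′ ⊆-refl) (cong (λ A → rank M A ⊓ (rk M ∸ j)) M′∪U∩S≡V∩S))
           (trans (rank-N′ I∩T⊆N′) (cong (λ k → k ⊓ (rank N (I ∩ T ∪ U ∩ T) + i)) ∣I∩T∪U∩T∣)) ⟩
    (rank M′ (I ∩ S) + ∣ I ∩ T ∣) ⊓ (rk M′ + rank N′ (I ∩ T)) + freeProductRank M N U
      ≡⟨ cong₂ _+_ (cong₂ (λ A B → (rank M′ A + ∣ B ∣) ⊓ (rk M′ + rank N′ B)) (sym I∩M′≡I∩S) (sym I∩N′≡I∩T))
                   (sym (rank-freeProduct M-mat N-mat S∩T=∅ U)) ⟩
    freeProductRank M′ N′ I + rank P U ∎
    where
    open ≡-Reasoning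
    I⊆V─U : I ⊆ V ─ U
    I⊆V─U = ⊆M′∪N′⇒⊆V─U I⊆G
    I∩S⊆M′ : I ∩ S ⊆ ground M′
    I∩S⊆M′ = subst (I ∩ S ⊆_) (sym ground-M′) (∩-monoˡ-⊆ S I⊆V─U)
    I∩T⊆N′ : I ∩ T ⊆ ground N′
    I∩T⊆N′ = subst (I ∩ T ⊆_) (sym ground-N′) (∩-monoˡ-⊆ T I⊆V─U)
    I∩M′≡I∩S : I ∩ ground M′ ≡ I ∩ S
    I∩M′≡I∩S = trans (cong (I ∩_) ground-M′) (p⊆q⇒p∩[q∩r]≡p∩r S I⊆V─U)
    I∩N′≡I∩T : I ∩ ground N′ ≡ I ∩ T
    I∩N′≡I∩T = trans (cong (I ∩_) ground-N′) (p⊆q⇒p∩[q∩r]≡p∩r T I⊆V─U)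
    ∣I∩T∪U∩T∣ : ∣ I ∩ T ∪ U ∩ T ∣ ≡ ∣ I ∩ T ∣ + ∣ U ∩ T ∣
    ∣I∩T∪U∩T∣ = ∣p∪q∣≡∣p∣+∣q∣ (I ∩ T) (U ∩ T)
      (disjoint-mono (⊆-trans (p∩q⊆p I T) I⊆V─U) (p∩q⊆p U T) (disjoint-─ V U))

  minor-rank-condition⇔ : ∀ {I} → I ⊆ ground M′ ∪ ground N′ →
    (rank (restrict P V) (I ∪ U) ≡ ∣ I ∣ + rank (restrict P V) U) ⇔ (freeProductRank M′ N′ I ≡ ∣ I ∣)
  minor-rank-condition⇔ {I} I⊆G = begin
    (rank (restrict P V) (I ∪ U) ≡ ∣ I ∣ + rank (restrict P V) U)
      ≡⟨ cong₂ (λ a b → a ≡ ∣ I ∣ + b)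
           (rank-restrict P (∪-least (⊆-trans (⊆M′∪N′⇒⊆V─U I⊆G) (p─q⊆p V U)) U⊆V)) (rank-restrict P U⊆V) ⟩
    (rank P (I ∪ U) ≡ ∣ I ∣ + rank P U)
      ≡⟨ cong (_≡ ∣ I ∣ + rank P U) (rank-minor-freeProduct I⊆G) ⟩
    (freeProductRank M′ N′ I + rank P U ≡ ∣ I ∣ + rank P U)
      ∼⟨ mk⇔ (+-cancelʳ-≡ (rank P U) _ _) (cong (_+ rank P U)) ⟩
    (freeProductRank M′ N′ I ≡ ∣ I ∣) ∎
    where open Related.EquationalReasoning

theorem5p3 : ∀ {n : ℕ} (M N : SetSystem n) → IsMatroid M → IsMatroid N →
    Disjoint (ground M) (ground N) →
    (U V : Subset n) → U ⊆ V → V ⊆ ground M ∪ ground N →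
    minor (freeProduct M N) U V
      ≅ freeProduct
          (minor (truncation^ (nullity N (U ∩ ground N)) M)
                 (U ∩ ground M) (V ∩ ground M))
          (minor (lift^ (corank M (V ∩ ground M)) N)
                 (U ∩ ground N) (V ∩ ground N))
theorem5p3 M N M-mat N-mat S∩T=∅ U V U⊆V _ = ground-minor-freeProduct , λ I → begin
  Indep (minor (freeProduct M N) U V) I
    ∼⟨ ⊆×-cong ground-minor-freeProduct minor-rank-condition⇔ ⟩
  (I ⊆ ground M′ ∪ ground N′ × freeProductRank M′ N′ I ≡ ∣ I ∣)
    ∼⟨ ⇔-sym (freeProduct-indep⇔ M′∩N′=∅ M′-indep⇔ I) ⟩
  Indep (freeProduct M′ N′) I ∎
  where
  open FreeProductMinor M-mat N-mat S∩T=∅ U⊆V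
  open Related.EquationalReasoning
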